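{- We have $$\sum_{n\ge0}\sum_{0\le k\le n}a(n,k)t^kx^n=\frac{(1-3tx^2+t^2x^4)(1-tx^2)^2}{(1-tx-tx^2)(1-x-tx^2)(1-2tx^2)^2},$$ or equivalently $$\sum_{n\ge0}\sum_{0\le k\le n/2}a(n,k)t^kx^n=\frac{(1-tx^2)^3}{(1-x-tx^2)(1-2tx^2)^2}.$$
   Context: $\Bbbk$ is a field of characteristic $0$; $\mathcal{M}$ is the free monoid on letters $D,U$; $\mathcal{W}=\Bbbk\langle D,U\mid DU-UD=1\rangle$; $\phi:\mathcal{M}\to\mathcal{W}$ is the monoid morphism with $D\mapsto D,U\mapsto U$. Words $u,v$ are Weyl-equivalent if $\phi(u)=\phi(v)$. For $0\le k\le n$, $a(n,k)$ is the number of Weyl-equivalence classes of words with $k$ letters $D$ and $n-k$ letters $U$. The identities are of formal power series in $x,t$. -}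

module Defs where

open import Data.Nat as ℕ using (ℕ; zero; suc; _≤_; _≤?_)
open import Data.Integer as ℤ using (ℤ; +_)
open import Data.List using (List; []; _∷_; length)
open import Data.List.Relation.Unary.All using (All)
open import Data.List.Relation.Unary.Any using (Any)
open import Data.List.Relation.Unary.AllPairs using (AllPairs)
open import Data.Product using (Σ; _×_)
open import Relation.Binary.PropositionalEquality using (_≡_)
open import Relation.Nullary using (¬_; yes; no)

data Letter : Set where
  D U : Letter

Word : Set
Word = List Letter

#D : Word → ℕ
#D []      = 0
#D (D ∷ w) = suc (#D w)
#D (U ∷ w) = #D w

-- The Weyl algebra W = k<D,U | DU - UD = 1> has the PBW basis
-- { U^i D^j }.  An element is represented by its coefficient function
-- (i , j) ↦ coefficient of U^i D^j.  φ(w) is computed by left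
-- multiplication on this basis:
--   U · U^i D^j = U^(i+1) D^j
--   D · U^i D^j = U^i D^(j+1) + i U^(i-1) D^j      (since [D,U^i] = i U^(i-1))
-- The image of a word has nonnegative integer coefficients, which embed
-- injectively in a field of characteristic 0.

φ : Word → ℕ → ℕ → ℕ
φ []      zero    zero    = 1
φ []      _       _       = 0
φ (U ∷ w) zero    j       = 0
φ (U ∷ w) (suc i) j       = φ w i j
φ (D ∷ w) i       zero    = suc i ℕ.* φ w (suc i) zero
φ (D ∷ w) i       (suc j) = φ w i j ℕ.+ suc i ℕ.* φ w (suc i) (suc j)

WeylEq : Word → Word → Set
WeylEq u v = ∀ i j → φ u i j ≡ φ v i j

InS : ℕ → ℕ → Word → Set
InS n k w = (length w ≡ n) × (#D w ≡ k)

NumClasses : ℕ → ℕ → ℕ → Set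
NumClasses n k c =
  Σ (List Word) λ reps →
    (length reps ≡ c) ×
    All (InS n k) reps ×
    AllPairs (λ u v → ¬ WeylEq u v) reps ×
    (∀ w → InS n k w → Any (WeylEq w) reps)

-- Formal power series in t, x with integer coefficients:
-- S p q = coefficient of t^p x^q.

Series : Set
Series = ℕ → ℕ → ℤ

sumTo : ℕ → (ℕ → ℤ) → ℤ
sumTo zero    f = f 0
sumTo (suc p) f = sumTo p f ℤ.+ f (suc p)

_⊕_ : Series → Series → Series
(f ⊕ g) p q = f p q ℤ.+ g p q

_⊖_ : Series → Series → Series
(f ⊖ g) p q = f p q ℤ.- g p q

_⊛_ : Series → Series → Series
(f ⊛ g) p q = sumTo p λ a → sumTo q λ b → f a b ℤ.* g (p ℕ.∸ a) (q ℕ.∸ b)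

infixl 6 _⊕_ _⊖_
infixl 7 _⊛_
infix 4 _≗ˢ_

const : ℤ → Series
const c zero zero = c
const c _    _    = + 0

𝟙 : Series
𝟙 = const (+ 1)

𝕥 : Series
𝕥 (suc zero) zero = + 1
𝕥 _          _    = + 0

𝕩 : Series
𝕩 zero (suc zero) = + 1
𝕩 _    _          = + 0

_≗ˢ_ : Series → Series → Set
f ≗ˢ g = ∀ p q → f p q ≡ g p q

x² : Series
x² = 𝕩 ⊛ 𝕩

tx² : Series
tx² = 𝕥 ⊛ x²

num₁ : Series
num₁ = (𝟙 ⊖ const (+ 3) ⊛ tx² ⊕ tx² ⊛ tx²) ⊛ ((𝟙 ⊖ tx²) ⊛ (𝟙 ⊖ tx²))

den₁ : Series
den₁ = (𝟙 ⊖ 𝕥 ⊛ 𝕩 ⊖ tx²) ⊛ (𝟙 ⊖ 𝕩 ⊖ tx²)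
       ⊛ ((𝟙 ⊖ const (+ 2) ⊛ tx²) ⊛ (𝟙 ⊖ const (+ 2) ⊛ tx²))

num₂ : Series
num₂ = (𝟙 ⊖ tx²) ⊛ (𝟙 ⊖ tx²) ⊛ (𝟙 ⊖ tx²)

den₂ : Series
den₂ = (𝟙 ⊖ 𝕩 ⊖ tx²) ⊛ ((𝟙 ⊖ const (+ 2) ⊛ tx²) ⊛ (𝟙 ⊖ const (+ 2) ⊛ tx²))

genA : (ℕ → ℕ → ℕ) → Series
genA a k n with k ≤? n
... | yes _ = + (a n k)
... | no  _ = + 0

genA½ : (ℕ → ℕ → ℕ) → Series
genA½ a k n with 2 ℕ.* k ≤? n
... | yes _ = + (a n k)
... | no  _ = + 0

{-# OPTIONS --safe #-}
-- Let the heights of a word be the values #U - #D of the suffixes following its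
-- letters D. Normal ordering gives φ(w) = Σⱼ cⱼ U^(j + #U - #D) Dʲ, where
-- Σⱼ cⱼ X(X-1)⋯(X-j+1) = ∏ (X + h) over these heights h; so words with the same
-- letter counts are Weyl-equivalent iff they have the same multiset of heights.
-- If 2k ≤ n, the path of heights ends at e = n - 2k ≥ 0 and the possible multisets
-- are those with arbitrary multiplicities at 1, …, e and positive ones on the
-- intervals of heights ≤ 0 and > e that the path crosses; the anti-automorphism
-- D ↔ U reduces 2k > n to this case. Counting these gives a(n, k) = F(n - 2k, k)
-- with F(e, k) = F(e - 1, k) + F(e, k - 1) for e ≥ 1 and Σₖ F(0, k) tᵏ =
-- (1 - t)²/(1 - 2t)². Hence, with Δ = Σₖ F(0, k) tᵏx²ᵏ, the parts L and V of
-- Σ a(n, k) tᵏxⁿ where 2k ≤ n and 2k > n satisfy (1 - x - tx²)L = (1 - tx²)Δ and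
-- (1 - tx - tx²)V = tx·Δ, while (1 - 2tx²)²Δ = (1 - tx²)²; the identities follow
-- by multiplying out.

module Submission where

open import Defs
open import Data.Nat using (ℕ; suc; _≤_)
open import Data.Product using (Σ; _×_; _,_)
open import Relation.Binary.PropositionalEquality

module FiniteSums where
  open import Data.Nat as ℕ using (ℕ; zero; suc; z≤n; _∸_)
  import Data.Nat.Properties as ℕP
  open import Data.Integer using (ℤ; +_; _+_; _-_; _*_)
  import Data.Integer.Properties as ℤP
  import Data.Integer.Tactic.RingSolver as ℤSolver
  open import Relation.Binary.PropositionalEquality
  import Algebra.Properties.CommutativeSemigroup as CommSemigroupProperties
  private module ℤ+ = CommSemigroupProperties ℤP.+-commutativeSemigroup

  sumTo-cong : ∀ N {f g : ℕ → ℤ} → (∀ j → f j ≡ g j) → sumTo N f ≡ sumTo N g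
  sumTo-cong zero    f≗g = f≗g 0
  sumTo-cong (suc N) f≗g = cong₂ _+_ (sumTo-cong N f≗g) (f≗g (suc N))

  sumTo-+ : ∀ N (f g : ℕ → ℤ) → sumTo N (λ j → f j + g j) ≡ sumTo N f + sumTo N g
  sumTo-+ zero    f g = refl
  sumTo-+ (suc N) f g = trans (cong (_+ (f (suc N) + g (suc N))) (sumTo-+ N f g))
                              (ℤ+.interchange (sumTo N f) (sumTo N g) (f (suc N)) (g (suc N)))

  sumTo-*ˡ : ∀ N c (f : ℕ → ℤ) → sumTo N (λ j → c * f j) ≡ c * sumTo N f
  sumTo-*ˡ zero    c f = refl
  sumTo-*ˡ (suc N) c f = trans (cong (_+ c * f (suc N)) (sumTo-*ˡ N c f))
                               (sym (ℤP.*-distribˡ-+ c (sumTo N f) (f (suc N))))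

  sumTo-*ʳ : ∀ N c (f : ℕ → ℤ) → sumTo N (λ j → f j * c) ≡ sumTo N f * c
  sumTo-*ʳ N c f = trans (sumTo-cong N (λ j → ℤP.*-comm (f j) c)) (trans (sumTo-*ˡ N c f) (ℤP.*-comm c (sumTo N f)))

  sumTo-- : ∀ N (f g : ℕ → ℤ) → sumTo N (λ j → f j - g j) ≡ sumTo N f - sumTo N g
  sumTo-- zero    f g = refl
  sumTo-- (suc N) f g = trans (cong (_+ (f (suc N) - g (suc N))) (sumTo-- N f g))
                              (rearrange (sumTo N f) (sumTo N g) (f (suc N)) (g (suc N)))
    where
    rearrange : ∀ a b c d → (a - b) + (c - d) ≡ (a + c) - (b + d)
    rearrange = ℤSolver.solve-∀

  sumTo-zero : ∀ N {f : ℕ → ℤ} → (∀ j → f j ≡ + 0) → sumTo N f ≡ + 0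
  sumTo-zero zero    f≗0 = f≗0 0
  sumTo-zero (suc N) f≗0 = cong₂ _+_ (sumTo-zero N f≗0) (f≗0 (suc N))

  sumTo-cong-≤ : ∀ N {f g : ℕ → ℤ} → (∀ j → j ℕ.≤ N → f j ≡ g j) → sumTo N f ≡ sumTo N g
  sumTo-cong-≤ zero    f≗g = f≗g 0 z≤n
  sumTo-cong-≤ (suc N) f≗g =
    cong₂ _+_ (sumTo-cong-≤ N (λ j j≤N → f≗g j (ℕP.m≤n⇒m≤1+n j≤N))) (f≗g (suc N) ℕP.≤-refl)

  sumTo-∸-suc : ∀ M (h : ℕ → ℕ → ℤ) → (∀ j → h j 0 ≡ + 0) →
                sumTo (suc M) (λ j → h j (suc M ∸ j)) ≡ sumTo M (λ j → h j (suc (M ∸ j)))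
  sumTo-∸-suc M h h-0 =
    trans (cong₂ _+_ (sumTo-cong-≤ M (λ j j≤M → cong (h j) (ℕP.+-∸-assoc 1 j≤M)))
                     (trans (cong (h (suc M)) (ℕP.n∸n≡0 M)) (h-0 (suc M))))
          (ℤP.+-identityʳ _)

  sumTo-∸-last : ∀ N (h : ℕ → ℕ → ℤ) → (∀ j i → h j (suc i) ≡ + 0) → sumTo N (λ j → h j (N ∸ j)) ≡ h N 0
  sumTo-∸-last zero    h h-suc = refl
  sumTo-∸-last (suc M) h h-suc =
    trans (cong₂ _+_ (sumTo-zero-≤ M (λ j j≤M → trans (cong (h j) (ℕP.+-∸-assoc 1 j≤M)) (h-suc j (M ∸ j))))
                     (cong (h (suc M)) (ℕP.n∸n≡0 M)))
          (ℤP.+-identityˡ _)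
    where
    sumTo-zero-≤ : ∀ N {f : ℕ → ℤ} → (∀ j → j ℕ.≤ N → f j ≡ + 0) → sumTo N f ≡ + 0
    sumTo-zero-≤ N f≗0 = trans (sumTo-cong-≤ N f≗0) (sumTo-zero N (λ _ → refl))

open FiniteSums

module NormalOrdering where
  open import Data.Nat as ℕ using (ℕ; zero; suc; s≤s)
  import Data.Nat.Properties as ℕP
  import Data.Integer as ℤ
  open import Data.Integer using (ℤ; +_; _+_; _-_; _*_; _^_; ∣_∣; _≟_)
  import Data.Integer.Properties as ℤP
  open import Data.Integer.Divisibility.Signed using (_∣_; divides; ∣m+n∣m⇒∣n; ∣m⇒∣m*n; ∣-refl; ∣⇒∣ᵤ)
  import Data.Integer.Tactic.RingSolver as ℤSolver
  import Data.Nat.Divisibility as ℕDiv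
  open import Data.List using (List; []; _∷_; _++_; length)
  open import Data.Product using (∃; ∃₂; _×_; _,_; proj₁; proj₂)
  open import Data.Sum using (inj₁; inj₂; [_,_]′)
  open import Function using (_∘_)
  open import Relation.Binary.PropositionalEquality
  open import Relation.Nullary using (¬_; yes; no; contradiction)
  import Algebra.Properties.CommutativeSemigroup as CommSemigroupProperties
  private module ℕ+ = CommSemigroupProperties ℕP.+-commutativeSemigroup
  private module ℤ+ = CommSemigroupProperties ℤP.+-commutativeSemigroup
  private module ℤ* = CommSemigroupProperties ℤP.*-commutativeSemigroup

  #U : Word → ℕ
  #U []      = 0
  #U (D ∷ w) = #U w
  #U (U ∷ w) = suc (#U w)

  #U+#D : ∀ w → #U w ℕ.+ #D w ≡ length w
  #U+#D []      = refl
  #U+#D (U ∷ w) = cong suc (#U+#D w)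
  #U+#D (D ∷ w) = trans (ℕP.+-suc (#U w) (#D w)) (cong suc (#U+#D w))

  height : Word → ℤ
  height w = + #U w - + #D w

  heights : Word → List ℤ
  heights []      = []
  heights (U ∷ w) = heights w
  heights (D ∷ w) = height w ∷ heights w

  -- Coefficients, in the falling factorial basis X(X-1)⋯(X-j+1), of
  -- (X + a)·P where f gives those of P.
  mulLinear : ℤ → (ℕ → ℤ) → ℕ → ℤ
  mulLinear a f zero    = a * f zero
  mulLinear a f (suc j) = f j + (a + + suc j) * f (suc j)

  ffCoeffs : List ℤ → ℕ → ℤ
  ffCoeffs []      zero    = + 1
  ffCoeffs []      (suc j) = + 0
  ffCoeffs (a ∷ l)         = mulLinear a (ffCoeffs l)

  height-≡⁻ : ∀ w e → height w ≡ + e → #U w ≡ e ℕ.+ #D w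
  height-≡⁻ w e eq =
    ℤP.+-injective (trans (sym (sub-add (+ #U w) (+ #D w))) (trans (cong (_+ + #D w) eq) (sym (ℤP.pos-+ e (#D w)))))
    where
    sub-add : ∀ x y → x - y + y ≡ x
    sub-add = ℤSolver.solve-∀

  height-offset : ∀ w i j → i ℕ.+ #D w ≡ j ℕ.+ #U w → + i ≡ height w + + j
  height-offset w i j eq = begin
    + i                            ≡⟨ add-sub (+ i) (+ #D w) ⟩
    (+ i + + #D w) - + #D w        ≡⟨ cong (_- + #D w) (sym (ℤP.pos-+ i (#D w))) ⟩
    + (i ℕ.+ #D w) - + #D w        ≡⟨ cong (λ z → + z - + #D w) eq ⟩
    + (j ℕ.+ #U w) - + #D w        ≡⟨ cong (_- + #D w) (ℤP.pos-+ j (#U w)) ⟩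
    (+ j + + #U w) - + #D w        ≡⟨ rearrange (+ j) (+ #U w) (+ #D w) ⟩
    height w + + j                 ∎
    where
    open ≡-Reasoning
    add-sub : ∀ x y → x ≡ (x + y) - y
    add-sub = ℤSolver.solve-∀
    rearrange : ∀ x y z → (x + y) - z ≡ (y - z) + x
    rearrange = ℤSolver.solve-∀

  height-≡ : ∀ w e → #U w ≡ e ℕ.+ #D w → height w ≡ + e
  height-≡ w e eq = sym (trans (height-offset w e 0 (sym eq)) (ℤP.+-identityʳ (height w)))

  -- Below the diagonal the coefficients vanish: the heights 0, -1, …, height w + 1
  -- all occur, so X = 0, 1, …, -height w - 1 are roots.
  mutual
    ffCoeffs-below : ∀ w j → #U w ℕ.+ j ℕ.< #D w → ffCoeffs (heights w) j ≡ + 0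
    ffCoeffs-below (U ∷ w) j lt = ffCoeffs-below w j (ℕP.<-trans (ℕP.n<1+n _) lt)
    ffCoeffs-below (D ∷ w) zero (s≤s le) =
      trans (cong (_* ffCoeffs (heights w) 0) (sym (ℤP.+-identityʳ (height w)))) (factor-vanishes w 0 le)
    ffCoeffs-below (D ∷ w) (suc j) (s≤s le) =
      cong₂ _+_ (ffCoeffs-below w j (ℕP.≤-trans (ℕP.≤-reflexive (sym (ℕP.+-suc (#U w) j))) le))
                (factor-vanishes w (suc j) le)

    factor-vanishes : ∀ w j → #U w ℕ.+ j ℕ.≤ #D w → (height w + + j) * ffCoeffs (heights w) j ≡ + 0
    factor-vanishes w j le with ℕP.m≤n⇒m<n∨m≡n le
    ... | inj₁ lt = trans (cong ((height w + + j) *_) (ffCoeffs-below w j lt)) (ℤP.*-zeroʳ (height w + + j))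
    ... | inj₂ eq = cong (_* ffCoeffs (heights w) j)
                         (sym (height-offset w 0 j (trans (sym eq) (ℕP.+-comm (#U w) j))))

  φ-diagonal : ∀ w i j → i ℕ.+ #D w ≡ j ℕ.+ #U w → + φ w i j ≡ ffCoeffs (heights w) j
  φ-diagonal []      zero    zero    eq = refl
  φ-diagonal []      (suc i) (suc j) eq = refl
  φ-diagonal (U ∷ w) zero    j       eq =
    sym (ffCoeffs-below w j (ℕP.≤-reflexive (trans (cong suc (ℕP.+-comm (#U w) j))
                                                   (trans (sym (ℕP.+-suc j (#U w))) (sym eq)))))
  φ-diagonal (U ∷ w) (suc i) j       eq = φ-diagonal w i j (ℕP.suc-injective (trans eq (ℕP.+-suc j (#U w))))
  φ-diagonal (D ∷ w) i       zero    eq = begin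
    + (suc i ℕ.* φ w (suc i) 0)        ≡⟨ ℤP.pos-* (suc i) _ ⟩
    + suc i * + φ w (suc i) 0          ≡⟨ cong₂ _*_ (trans (height-offset w (suc i) 0 eq′) (ℤP.+-identityʳ (height w)))
                                                     (φ-diagonal w (suc i) 0 eq′) ⟩
    height w * ffCoeffs (heights w) 0  ∎
    where
    open ≡-Reasoning
    eq′ = trans (sym (ℕP.+-suc i (#D w))) eq
  φ-diagonal (D ∷ w) i       (suc j) eq = begin
    + (φ w i j ℕ.+ suc i ℕ.* φ w (suc i) (suc j))
      ≡⟨ trans (ℤP.pos-+ (φ w i j) _) (cong (_+_ (+ φ w i j)) (ℤP.pos-* (suc i) _)) ⟩
    + φ w i j + + suc i * + φ w (suc i) (suc j)
      ≡⟨ cong₂ _+_ (φ-diagonal w i j (ℕP.suc-injective eq′))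
                   (cong₂ _*_ (height-offset w (suc i) (suc j) eq′) (φ-diagonal w (suc i) (suc j) eq′)) ⟩
    ffCoeffs (heights w) j + (height w + + suc j) * ffCoeffs (heights w) (suc j)
      ∎
    where
    open ≡-Reasoning
    eq′ = trans (sym (ℕP.+-suc i (#D w))) eq

  φ-offDiagonal : ∀ w i j → i ℕ.+ #D w ≢ j ℕ.+ #U w → φ w i j ≡ 0
  φ-offDiagonal []      zero    zero    ne = contradiction refl ne
  φ-offDiagonal []      zero    (suc j) ne = refl
  φ-offDiagonal []      (suc i) j       ne = refl
  φ-offDiagonal (U ∷ w) zero    j       ne = refl
  φ-offDiagonal (U ∷ w) (suc i) j       ne =
    φ-offDiagonal w i j (λ e → ne (trans (cong suc e) (sym (ℕP.+-suc j (#U w)))))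
  φ-offDiagonal (D ∷ w) i       zero    ne =
    trans (cong (suc i ℕ.*_) (φ-offDiagonal w (suc i) 0 (ne ∘ trans (ℕP.+-suc i (#D w))))) (ℕP.*-zeroʳ (suc i))
  φ-offDiagonal (D ∷ w) i       (suc j) ne =
    cong₂ ℕ._+_ (φ-offDiagonal w i j (ne ∘ trans (ℕP.+-suc i (#D w)) ∘ cong suc))
                (trans (cong (suc i ℕ.*_) (φ-offDiagonal w (suc i) (suc j) (ne ∘ trans (ℕP.+-suc i (#D w)))))
                       (ℕP.*-zeroʳ (suc i)))

  δ : ℤ → ℤ → ℕ
  δ h a with a ≟ h
  ... | yes _ = 1
  ... | no  _ = 0

  δ-refl : ∀ a → δ a a ≡ 1
  δ-refl a with a ≟ a
  ... | yes _ = refl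
  ... | no a≢a = contradiction refl a≢a

  δ-≢ : ∀ h a → a ≢ h → δ h a ≡ 0
  δ-≢ h a a≢h with a ≟ h
  ... | yes a≡h = contradiction a≡h a≢h
  ... | no  _   = refl

  multiplicity : ℤ → List ℤ → ℕ
  multiplicity h []      = 0
  multiplicity h (a ∷ l) = δ h a ℕ.+ multiplicity h l

  infix 4 _≈ₘ_
  _≈ₘ_ : List ℤ → List ℤ → Set
  l ≈ₘ l′ = ∀ h → multiplicity h l ≡ multiplicity h l′

  multiplicity-middle : ∀ h xs a ys → multiplicity h (xs ++ a ∷ ys) ≡ δ h a ℕ.+ multiplicity h (xs ++ ys)
  multiplicity-middle h []       a ys = refl
  multiplicity-middle h (x ∷ xs) a ys =
    trans (cong (δ h x ℕ.+_) (multiplicity-middle h xs a ys)) (ℕ+.x∙yz≈y∙xz (δ h x) (δ h a) _)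

  split-at : ∀ a l → multiplicity a l ≢ 0 → ∃ λ xs → ∃ λ ys → l ≡ xs ++ a ∷ ys
  split-at a []      m≢0 = contradiction refl m≢0
  split-at a (b ∷ l) m≢0 with b ≟ a
  ... | yes refl = [] , l , refl
  ... | no  _ with split-at a l m≢0
  ...   | xs , ys , refl = b ∷ xs , ys , refl

  mulLinear-cong : ∀ a {f g : ℕ → ℤ} → (∀ j → f j ≡ g j) → ∀ j → mulLinear a f j ≡ mulLinear a g j
  mulLinear-cong a f≗g zero    = cong (a *_) (f≗g zero)
  mulLinear-cong a f≗g (suc j) = cong₂ (λ x y → x + (a + + suc j) * y) (f≗g j) (f≗g (suc j))

  mulLinear-comm : ∀ a b f j → mulLinear a (mulLinear b f) j ≡ mulLinear b (mulLinear a f) j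
  mulLinear-comm a b f zero = ℤ*.x∙yz≈y∙xz a b (f 0)
  mulLinear-comm a b f 1    = comm₁ a b (f 0) (f 1)
    where
    comm₁ : ∀ a b x y → b * x + (a + + 1) * (x + (b + + 1) * y) ≡ a * x + (b + + 1) * (x + (a + + 1) * y)
    comm₁ = ℤSolver.solve-∀
  mulLinear-comm a b f (suc (suc j)) = comm₂ a b (f j) (f (suc j)) (f (suc (suc j))) (+ suc j)
    where
    comm₂ : ∀ a b x y z s → (x + (b + s) * y) + (a + (+ 1 + s)) * (y + (b + (+ 1 + s)) * z)
                          ≡ (x + (a + s) * y) + (b + (+ 1 + s)) * (y + (a + (+ 1 + s)) * z)
    comm₂ = ℤSolver.solve-∀

  ffCoeffs-middle : ∀ xs a ys j → ffCoeffs (xs ++ a ∷ ys) j ≡ ffCoeffs (a ∷ xs ++ ys) j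
  ffCoeffs-middle []       a ys j = refl
  ffCoeffs-middle (x ∷ xs) a ys j =
    trans (mulLinear-cong x (ffCoeffs-middle xs a ys) j) (mulLinear-comm x a (ffCoeffs (xs ++ ys)) j)

  ∷-≈ₘ-split : ∀ a l l′ → a ∷ l ≈ₘ l′ → ∃₂ λ xs ys → l′ ≡ xs ++ a ∷ ys × l ≈ₘ xs ++ ys
  ∷-≈ₘ-split a l l′ a∷l≈l′ with split-at a l′ a∈l′
    where
    a∈l′ : multiplicity a l′ ≢ 0
    a∈l′ m≡0 = ℕP.1+n≢0 (trans (cong (ℕ._+ multiplicity a l) (sym (δ-refl a))) (trans (a∷l≈l′ a) m≡0))
  ... | xs , ys , refl =
    xs , ys , refl , λ h → ℕP.+-cancelˡ-≡ (δ h a) _ _ (trans (a∷l≈l′ h) (multiplicity-middle h xs a ys))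

  ffCoeffs-≈ₘ : ∀ l l′ → l ≈ₘ l′ → ∀ j → ffCoeffs l j ≡ ffCoeffs l′ j
  ffCoeffs-≈ₘ []      []       _    j = refl
  ffCoeffs-≈ₘ []      (b ∷ l′) l≈l′ j = contradiction (trans (l≈l′ b) (cong (ℕ._+ multiplicity b l′) (δ-refl b))) λ ()
  ffCoeffs-≈ₘ (a ∷ l) l′       l≈l′ j with ∷-≈ₘ-split a l l′ l≈l′
  ... | xs , ys , refl , l≈xs++ys =
    trans (mulLinear-cong a (ffCoeffs-≈ₘ l (xs ++ ys) l≈xs++ys) j) (sym (ffCoeffs-middle xs a ys j))

  fallingFactorial : ℤ → ℕ → ℤ
  fallingFactorial m zero    = + 1
  fallingFactorial m (suc j) = fallingFactorial m j * (m - + j)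

  linearProduct : List ℤ → ℤ → ℤ
  linearProduct []      m = + 1
  linearProduct (a ∷ l) m = (m + a) * linearProduct l m

  ffCoeffs-degree : ∀ l j → length l ℕ.< j → ffCoeffs l j ≡ + 0
  ffCoeffs-degree []      (suc j) _        = refl
  ffCoeffs-degree (a ∷ l) (suc j) (s≤s lt) =
    trans (cong₂ (λ x y → x + (a + + suc j) * y) (ffCoeffs-degree l j lt) (ffCoeffs-degree l (suc j) (ℕP.m≤n⇒m≤1+n lt)))
          (trans (ℤP.+-identityˡ _) (ℤP.*-zeroʳ (a + + suc j)))

  -- Summation by parts: the terms f (j-1)·F j of mulLinear are moved to index j - 1.
  sumTo-mulLinear : ∀ N a (f F : ℕ → ℤ) →
                    sumTo N (λ j → mulLinear a f j * F j) + f N * F (suc N)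
                    ≡ sumTo N (λ j → (a + + j) * f j * F j + f j * F (suc j))
  sumTo-mulLinear zero    a f F = cong (λ x → x * f 0 * F 0 + f 0 * F 1) (sym (ℤP.+-identityʳ a))
  sumTo-mulLinear (suc N) a f F = begin
    sumTo N M + (f N + (a + + suc N) * f (suc N)) * F (suc N) + f (suc N) * F (suc (suc N))
      ≡⟨ regroup (sumTo N M) (f N) (a + + suc N) (f (suc N)) (F (suc N)) (F (suc (suc N))) ⟩
    (sumTo N M + f N * F (suc N)) + ((a + + suc N) * f (suc N) * F (suc N) + f (suc N) * F (suc (suc N)))
      ≡⟨ cong (_+ ((a + + suc N) * f (suc N) * F (suc N) + f (suc N) * F (suc (suc N)))) (sumTo-mulLinear N a f F) ⟩
    sumTo (suc N) (λ j → (a + + j) * f j * F j + f j * F (suc j)) ∎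
    where
    open ≡-Reasoning
    M = λ j → mulLinear a f j * F j
    regroup : ∀ s x c y u v → s + (x + c * y) * u + y * v ≡ (s + x * u) + (c * y * u + y * v)
    regroup = ℤSolver.solve-∀

  ffCoeffs-eval : ∀ l N m → length l ℕ.≤ N →
                  sumTo N (λ j → ffCoeffs l j * fallingFactorial m j) ≡ linearProduct l m
  ffCoeffs-eval []      N m _ = constant N
    where
    constant : ∀ N → sumTo N (λ j → ffCoeffs [] j * fallingFactorial m j) ≡ + 1
    constant zero    = refl
    constant (suc N) = cong (_+ + 0) (constant N)
  ffCoeffs-eval (a ∷ l) N m le = begin
    sumTo N (λ j → mulLinear a f j * F j)
      ≡⟨ sym (trans (cong (λ x → sumTo N (λ j → mulLinear a f j * F j) + x * F (suc N)) (ffCoeffs-degree l N le))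
                    (ℤP.+-identityʳ _)) ⟩
    sumTo N (λ j → mulLinear a f j * F j) + f N * F (suc N)
      ≡⟨ sumTo-mulLinear N a f F ⟩
    sumTo N (λ j → (a + + j) * f j * F j + f j * F (suc j))
      ≡⟨ sumTo-cong N (λ j → factor a (+ j) (f j) (F j) m) ⟩
    sumTo N (λ j → (m + a) * (f j * F j))
      ≡⟨ sumTo-*ˡ N (m + a) _ ⟩
    (m + a) * sumTo N (λ j → f j * F j)
      ≡⟨ cong ((m + a) *_) (ffCoeffs-eval l N m (ℕP.<⇒≤ le)) ⟩
    (m + a) * linearProduct l m ∎
    where
    open ≡-Reasoning
    f = ffCoeffs l
    F = fallingFactorial m
    -- (m + a)·m^(j) = (a + j)·m^(j) + m^(j+1) for the falling factorial m^(j)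
    factor : ∀ a j x y m → (a + j) * x * y + x * (y * (m - j)) ≡ (m + a) * (x * y)
    factor = ℤSolver.solve-∀

  cofactor : ℤ → List ℤ → ℤ
  cofactor h []      = + 1
  cofactor h (a ∷ l) with a ≟ h
  ... | yes _ = cofactor h l
  ... | no  _ = (a - h) * cofactor h l

  cofactor-nonzero : ∀ h l → cofactor h l ≢ + 0
  cofactor-nonzero h []      ()
  cofactor-nonzero h (a ∷ l) with a ≟ h
  ... | yes _   = cofactor-nonzero h l
  ... | no  a≢h = λ eq → [ a≢h ∘ ℤP.i-j≡0⇒i≡j a h , cofactor-nonzero h l ]′ (ℤP.i*j≡0⇒i≡0∨j≡0 (a - h) eq)

  linearProduct-expand : ∀ h n l → ∃ λ q → linearProduct l (n - h) ≡ n ^ multiplicity h l * (n * q + cofactor h l)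
  linearProduct-expand h n []      = + 0 , constant n
    where
    constant : ∀ n → + 1 ≡ + 1 * (n * + 0 + + 1)
    constant = ℤSolver.solve-∀
  linearProduct-expand h n (a ∷ l) with linearProduct-expand h n l
  ... | q , eq with a ≟ h
  ...   | yes refl = q , trans (cong ((n - a + a) *_) eq) (root n a (n ^ multiplicity a l) q (cofactor a l))
    where
    root : ∀ n a X q P → (n - a + a) * (X * (n * q + P)) ≡ n * X * (n * q + P)
    root = ℤSolver.solve-∀
  ...   | no  _    = n * q + q * (a - h) + cofactor h l ,
                     trans (cong ((n - h + a) *_) eq) (unit n a h (n ^ multiplicity h l) q (cofactor h l))
    where
    unit : ∀ n a h X q P → (n - h + a) * (X * (n * q + P)) ≡ X * (n * (n * q + q * (a - h) + P) + (a - h) * P)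
    unit = ℤSolver.solve-∀

  ∤-remainder : ∀ n q P → P ≢ + 0 → ∣ P ∣ ℕ.< ∣ n ∣ → ¬ (n ∣ n * q + P)
  ∤-remainder n q P P≢0 small n∣nq+P =
    ℕP.<⇒≱ small (ℕDiv.∣⇒≤ {{ℕ.≢-nonZero (P≢0 ∘ ℤP.∣i∣≡0⇒i≡0)}} (∣⇒∣ᵤ n∣P))
    where
    n∣P : n ∣ P
    n∣P = ∣m+n∣m⇒∣n n∣nq+P (∣m⇒∣m*n q ∣-refl)

  ∣^suc-* : ∀ n β B → n ∣ n ^ suc β * B
  ∣^suc-* n β B = divides (n ^ β * B) (ℤ*.xy∙z≈yz∙x n (n ^ β) B)

  ^-*-injective : ∀ n α β A B → n ≢ + 0 → ¬ (n ∣ A) → ¬ (n ∣ B) → n ^ α * A ≡ n ^ β * B → α ≡ β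
  ^-*-injective n zero    zero    A B n≢0 n∤A n∤B eq = refl
  ^-*-injective n zero    (suc β) A B n≢0 n∤A n∤B eq =
    contradiction (subst (n ∣_) (trans (sym eq) (ℤP.*-identityˡ A)) (∣^suc-* n β B)) n∤A
  ^-*-injective n (suc α) zero    A B n≢0 n∤A n∤B eq =
    contradiction (subst (n ∣_) (trans eq (ℤP.*-identityˡ B)) (∣^suc-* n α A)) n∤B
  ^-*-injective n (suc α) (suc β) A B n≢0 n∤A n∤B eq =
    cong suc (^-*-injective n α β A B n≢0 n∤A n∤B (ℤP.*-cancelˡ-≡ n _ _ {{ℤ.≢-nonZero n≢0}}
      (trans (sym (ℤP.*-assoc n _ A)) (trans eq (ℤP.*-assoc n _ B)))))

  -- multiplicity h l is the exponent of n in linearProduct l (n - h) once n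
  -- exceeds both cofactors.
  linearProduct-injective : ∀ l l′ → (∀ m → linearProduct l m ≡ linearProduct l′ m) → l ≈ₘ l′
  linearProduct-injective l l′ same h =
    ^-*-injective n _ _ _ _ (λ ())
      (∤-remainder n q (cofactor h l) (cofactor-nonzero h l) (s≤s (ℕP.m≤m+n _ _)))
      (∤-remainder n q′ (cofactor h l′) (cofactor-nonzero h l′) (s≤s (ℕP.m≤n+m _ _)))
      (trans (sym eq) (trans (same (n - h)) eq′))
    where
    n = + suc (∣ cofactor h l ∣ ℕ.+ ∣ cofactor h l′ ∣)
    q = proj₁ (linearProduct-expand h n l)
    eq = proj₂ (linearProduct-expand h n l)
    q′ = proj₁ (linearProduct-expand h n l′)
    eq′ = proj₂ (linearProduct-expand h n l′)

  module _ (u v : Word) (#U≡ : #U u ≡ #U v) (#D≡ : #D u ≡ #D v) where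

    private
      transport : ∀ {i j} → i ℕ.+ #D u ≡ j ℕ.+ #U u → i ℕ.+ #D v ≡ j ℕ.+ #U v
      transport = subst₂ (λ d e → _ ℕ.+ d ≡ _ ℕ.+ e) #D≡ #U≡

    weylEq⇒ffCoeffs : WeylEq u v → ∀ j → ffCoeffs (heights u) j ≡ ffCoeffs (heights v) j
    weylEq⇒ffCoeffs u≈v j with #D u ℕ.≤? j ℕ.+ #U u
    ... | yes le = begin
      ffCoeffs (heights u) j ≡⟨ sym (φ-diagonal u i j onDiag) ⟩
      + φ u i j              ≡⟨ cong +_ (u≈v i j) ⟩
      + φ v i j              ≡⟨ φ-diagonal v i j (transport onDiag) ⟩
      ffCoeffs (heights v) j ∎
      where
      open ≡-Reasoning
      i = j ℕ.+ #U u ℕ.∸ #D u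
      onDiag : i ℕ.+ #D u ≡ j ℕ.+ #U u
      onDiag = ℕP.m∸n+n≡m le
    ... | no  gt = trans (ffCoeffs-below u j below) (sym (ffCoeffs-below v j below′))
      where
      below : #U u ℕ.+ j ℕ.< #D u
      below = subst (ℕ._< #D u) (ℕP.+-comm j (#U u)) (ℕP.≰⇒> gt)
      below′ : #U v ℕ.+ j ℕ.< #D v
      below′ = subst₂ ℕ._<_ (cong (ℕ._+ j) #U≡) #D≡ below

    weylEq⇒≈ₘ : WeylEq u v → heights u ≈ₘ heights v
    weylEq⇒≈ₘ u≈v = linearProduct-injective (heights u) (heights v) λ m →
      trans (sym (ffCoeffs-eval (heights u) N m (ℕP.m≤m+n _ _)))
            (trans (sumTo-cong N (λ j → cong (_* fallingFactorial m j) (weylEq⇒ffCoeffs u≈v j)))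
                   (ffCoeffs-eval (heights v) N m (ℕP.m≤n+m _ _)))
      where
      N = length (heights u) ℕ.+ length (heights v)

    ≈ₘ⇒weylEq : heights u ≈ₘ heights v → WeylEq u v
    ≈ₘ⇒weylEq hu≈hv i j with i ℕ.+ #D u ℕ.≟ j ℕ.+ #U u
    ... | yes onDiag = ℤP.+-injective (begin
      + φ u i j              ≡⟨ φ-diagonal u i j onDiag ⟩
      ffCoeffs (heights u) j ≡⟨ ffCoeffs-≈ₘ (heights u) (heights v) hu≈hv j ⟩
      ffCoeffs (heights v) j ≡⟨ sym (φ-diagonal v i j (transport onDiag)) ⟩
      + φ v i j              ∎)
      where open ≡-Reasoning
    ... | no  offDiag = trans (φ-offDiagonal u i j offDiag) (sym (φ-offDiagonal v i j (offDiag ∘ transport⁻)))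
      where
      transport⁻ : i ℕ.+ #D v ≡ j ℕ.+ #U v → i ℕ.+ #D u ≡ j ℕ.+ #U u
      transport⁻ = subst₂ (λ d e → i ℕ.+ d ≡ j ℕ.+ e) (sym #D≡) (sym #U≡)

open NormalOrdering

module Mirror where
  open import Data.Nat as ℕ using (ℕ; zero; suc; _+_; _*_; _∸_)
  import Data.Nat.Properties as ℕP
  import Data.Nat.Tactic.RingSolver as ℕSolver
  open import Data.List using ([]; _∷_; _++_; length; map)
  import Data.List.Properties as ListP
  import Data.List.Relation.Unary.All as All
  import Data.List.Relation.Unary.All.Properties as AllP
  import Data.List.Relation.Unary.Any as Any
  import Data.List.Relation.Unary.Any.Properties as AnyP
  import Data.List.Relation.Unary.AllPairs as AllPairs
  import Data.List.Relation.Unary.AllPairs.Properties as AllPairsP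
  open import Data.Product using (_,_)
  open import Function using (_∘_)
  open import Relation.Binary.PropositionalEquality

  swap : Letter → Letter
  swap D = U
  swap U = D

  -- On words, the anti-automorphism D ↦ U, U ↦ D of the Weyl algebra.
  mirror : Word → Word
  mirror []      = []
  mirror (c ∷ w) = mirror w ++ swap c ∷ []

  -- Coefficients of c·P and P·c in the basis U^i D^j, given those of P.
  mulˡ mulʳ : Letter → (ℕ → ℕ → ℕ) → ℕ → ℕ → ℕ
  mulˡ U f zero    j       = 0
  mulˡ U f (suc i) j       = f i j
  mulˡ D f i       zero    = suc i * f (suc i) zero
  mulˡ D f i       (suc j) = f i j + suc i * f (suc i) (suc j)
  mulʳ D f i       zero    = 0
  mulʳ D f i       (suc j) = f i j
  mulʳ U f zero    j       = suc j * f zero (suc j)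
  mulʳ U f (suc i) j       = f i j + suc j * f (suc i) (suc j)

  φ-∷ : ∀ c w i j → φ (c ∷ w) i j ≡ mulˡ c (φ w) i j
  φ-∷ U w zero    j       = refl
  φ-∷ U w (suc i) j       = refl
  φ-∷ D w i       zero    = refl
  φ-∷ D w i       (suc j) = refl

  mulˡ-cong : ∀ c {f g : ℕ → ℕ → ℕ} → (∀ i j → f i j ≡ g i j) → ∀ i j → mulˡ c f i j ≡ mulˡ c g i j
  mulˡ-cong U f≗g zero    j       = refl
  mulˡ-cong U f≗g (suc i) j       = f≗g i j
  mulˡ-cong D f≗g i       zero    = cong (suc i *_) (f≗g (suc i) zero)
  mulˡ-cong D f≗g i       (suc j) = cong₂ (λ x y → x + suc i * y) (f≗g i j) (f≗g (suc i) (suc j))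

  mulʳ-cong : ∀ c {f g : ℕ → ℕ → ℕ} → (∀ i j → f i j ≡ g i j) → ∀ i j → mulʳ c f i j ≡ mulʳ c g i j
  mulʳ-cong D f≗g i       zero    = refl
  mulʳ-cong D f≗g i       (suc j) = f≗g i j
  mulʳ-cong U f≗g zero    j       = cong (suc j *_) (f≗g zero (suc j))
  mulʳ-cong U f≗g (suc i) j       = cong₂ (λ x y → x + suc j * y) (f≗g i j) (f≗g (suc i) (suc j))

  mulˡ-mulʳ : ∀ a c f i j → mulˡ a (mulʳ c f) i j ≡ mulʳ c (mulˡ a f) i j
  mulˡ-mulʳ U D f zero    zero    = refl
  mulˡ-mulʳ U D f zero    (suc j) = refl
  mulˡ-mulʳ U D f (suc i) zero    = refl
  mulˡ-mulʳ U D f (suc i) (suc j) = refl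
  mulˡ-mulʳ U U f zero    j       = sym (ℕP.*-zeroʳ (suc j))
  mulˡ-mulʳ U U f (suc zero)    j = refl
  mulˡ-mulʳ U U f (suc (suc i)) j = refl
  mulˡ-mulʳ D D f i       zero    = ℕP.*-zeroʳ (suc i)
  mulˡ-mulʳ D D f i (suc zero)    = refl
  mulˡ-mulʳ D D f i (suc (suc j)) = refl
  mulˡ-mulʳ D U f zero    zero    = refl
  mulˡ-mulʳ D U f (suc i) zero    = assoc₁ i (f (suc i) 0) (f (suc (suc i)) 1)
    where
    assoc₁ : ∀ i x y → suc (suc i) * (x + 1 * y) ≡ suc i * x + 1 * (x + suc (suc i) * y)
    assoc₁ = ℕSolver.solve-∀
  mulˡ-mulʳ D U f zero    (suc j) = assoc₂ j (f 0 (suc j)) (f 1 (suc (suc j)))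
    where
    assoc₂ : ∀ j x y → suc j * x + 1 * (x + suc (suc j) * y) ≡ suc (suc j) * (x + 1 * y)
    assoc₂ = ℕSolver.solve-∀
  mulˡ-mulʳ D U f (suc i) (suc j) = assoc₃ i j (f i j) (f (suc i) (suc j)) (f (suc (suc i)) (suc (suc j)))
    where
    assoc₃ : ∀ i j x y z → (x + suc j * y) + suc (suc i) * (y + suc (suc j) * z)
                         ≡ (x + suc i * y) + suc (suc j) * (y + suc (suc i) * z)
    assoc₃ = ℕSolver.solve-∀

  φ-∷ʳ : ∀ w c i j → φ (w ++ c ∷ []) i j ≡ mulʳ c (φ w) i j
  φ-∷ʳ []      D i       zero          = ℕP.*-zeroʳ (suc i)
  φ-∷ʳ []      D zero    (suc zero)    = refl
  φ-∷ʳ []      D zero    (suc (suc j)) = refl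
  φ-∷ʳ []      D (suc i) (suc j)       = ℕP.*-zeroʳ (suc (suc i))
  φ-∷ʳ []      U zero    j             = sym (ℕP.*-zeroʳ (suc j))
  φ-∷ʳ []      U (suc zero) zero       = refl
  φ-∷ʳ []      U (suc zero) (suc j)    = sym (ℕP.*-zeroʳ (suc (suc j)))
  φ-∷ʳ []      U (suc (suc i)) zero    = refl
  φ-∷ʳ []      U (suc (suc i)) (suc j) = sym (ℕP.*-zeroʳ (suc (suc j)))
  φ-∷ʳ (a ∷ w) c i j = begin
    φ (a ∷ w ++ c ∷ []) i j      ≡⟨ φ-∷ a (w ++ c ∷ []) i j ⟩
    mulˡ a (φ (w ++ c ∷ [])) i j ≡⟨ mulˡ-cong a (φ-∷ʳ w c) i j ⟩
    mulˡ a (mulʳ c (φ w)) i j    ≡⟨ mulˡ-mulʳ a c (φ w) i j ⟩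
    mulʳ c (mulˡ a (φ w)) i j    ≡⟨ mulʳ-cong c (λ i j → sym (φ-∷ a w i j)) i j ⟩
    mulʳ c (φ (a ∷ w)) i j       ∎
    where open ≡-Reasoning

  mulʳ-swap : ∀ c f i j → mulʳ (swap c) (λ x y → f y x) i j ≡ mulˡ c f j i
  mulʳ-swap U f i zero    = refl
  mulʳ-swap U f i (suc j) = refl
  mulʳ-swap D f zero    j = refl
  mulʳ-swap D f (suc i) j = refl

  φ-mirror : ∀ w i j → φ (mirror w) i j ≡ φ w j i
  φ-mirror []      zero    zero    = refl
  φ-mirror []      zero    (suc j) = refl
  φ-mirror []      (suc i) zero    = refl
  φ-mirror []      (suc i) (suc j) = refl
  φ-mirror (c ∷ w) i j = begin
    φ (mirror w ++ swap c ∷ []) i j           ≡⟨ φ-∷ʳ (mirror w) (swap c) i j ⟩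
    mulʳ (swap c) (φ (mirror w)) i j           ≡⟨ mulʳ-cong (swap c) (φ-mirror w) i j ⟩
    mulʳ (swap c) (λ x y → φ w y x) i j        ≡⟨ mulʳ-swap c (φ w) i j ⟩
    mulˡ c (φ w) j i                           ≡⟨ sym (φ-∷ c w j i) ⟩
    φ (c ∷ w) j i                              ∎
    where open ≡-Reasoning

  mirror-weylEq⁻ : ∀ u v → WeylEq (mirror u) (mirror v) → WeylEq u v
  mirror-weylEq⁻ u v mu≈mv i j = trans (sym (φ-mirror u j i)) (trans (mu≈mv j i) (φ-mirror v j i))

  mirror-weylEq-transpose : ∀ u v → WeylEq (mirror u) v → WeylEq u (mirror v)
  mirror-weylEq-transpose u v mu≈v i j = trans (sym (φ-mirror u j i)) (trans (mu≈v j i) (sym (φ-mirror v i j)))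

  #D-++ : ∀ u v → #D (u ++ v) ≡ #D u + #D v
  #D-++ []      v = refl
  #D-++ (D ∷ u) v = cong suc (#D-++ u v)
  #D-++ (U ∷ u) v = #D-++ u v

  #D-mirror : ∀ w → #D (mirror w) ≡ #U w
  #D-mirror []      = refl
  #D-mirror (U ∷ w) = trans (#D-++ (mirror w) (D ∷ [])) (trans (cong (_+ 1) (#D-mirror w)) (ℕP.+-comm (#U w) 1))
  #D-mirror (D ∷ w) = trans (#D-++ (mirror w) (U ∷ [])) (trans (cong (_+ 0) (#D-mirror w)) (ℕP.+-identityʳ (#U w)))

  length-mirror : ∀ w → length (mirror w) ≡ length w
  length-mirror []      = refl
  length-mirror (c ∷ w) = trans (ListP.length-++ (mirror w)) (trans (cong (_+ 1) (length-mirror w)) (ℕP.+-comm (length w) 1))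

  InS-mirror : ∀ {n k} w → InS n k w → InS n (n ∸ k) (mirror w)
  InS-mirror w (refl , refl) =
    length-mirror w , trans (#D-mirror w) (trans (sym (ℕP.m+n∸n≡m (#U w) (#D w))) (cong (_∸ #D w) (#U+#D w)))

  NumClasses-mirror : ∀ {n k c} → k ℕ.≤ n → NumClasses n (n ∸ k) c → NumClasses n k c
  NumClasses-mirror {n} {k} k≤n (reps , length≡ , inS , distinct , complete) =
    map mirror reps ,
    trans (ListP.length-map mirror reps) length≡ ,
    AllP.map⁺ (All.map (λ {w} w∈ → subst (λ k′ → InS n k′ (mirror w)) (ℕP.m∸[m∸n]≡n k≤n) (InS-mirror w w∈)) inS) ,
    AllPairsP.map⁺ (AllPairs.map (λ {u} {v} u≉v → u≉v ∘ mirror-weylEq⁻ u v) distinct) ,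
    λ w w∈ → AnyP.map⁺ (Any.map (λ {r} → mirror-weylEq-transpose w r) (complete (mirror w) (InS-mirror w w∈)))

open Mirror

module Profiles where
  open import Data.Nat as ℕ using (ℕ; zero; suc; _+_)
  import Data.Nat.Properties as ℕP
  import Data.Nat.Tactic.RingSolver as ℕSolver
  open import Data.Integer as ℤ using (ℤ; +_; -[1+_])
  import Data.Integer.Properties as ℤP
  import Data.Integer.Tactic.RingSolver as ℤSolver
  open import Data.List using (List; []; _∷_; _++_; length; map; foldr; drop; concat; replicate)
  open import Data.Nat.ListAction using (sum)
  import Data.List.Properties as ListP
  open import Data.Product using (_×_; _,_)
  open import Function using (_∘_; flip)
  open import Relation.Binary.PropositionalEquality
  open import Relation.Nullary using (yes; no; contradiction)

  Triple : Set
  Triple = List ℕ × List ℕ × List ℕ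

  -- The multiplicities of the heights of a word, built along its suffixes.
  -- At height e ≥ 0, nonneg (l , ms , r) gives those of e, e-1, …, 1 (ms) and,
  -- minus one, those of 0, -1, -2, … (l) and of e+1, e+2, … (r): each such
  -- height is crossed downwards, so these are positive up to the extreme height.
  -- At height -1-length ms, neg lb m ms r gives, minus one, those of the current
  -- height and below (lb), of the heights above it up to 0 (m ∷ ms) and of 1, 2, … (r).
  data Profile : Set where
    nonneg : Triple → Profile
    neg    : List ℕ → ℕ → List ℕ → List ℕ → Profile

  headCount : List ℕ → ℕ
  headCount []      = 0
  headCount (c ∷ _) = suc c

  step : Letter → Profile → Profile
  step U (nonneg (l , ms , r))     = nonneg (l , headCount r ∷ ms , drop 1 r)
  step D (nonneg (l , m ∷ ms , r)) = nonneg (l , ms , m ∷ r)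
  step D (nonneg (l , [] , r))     = neg (drop 1 l) (headCount l) [] r
  step U (neg lb m [] r)           = nonneg (m ∷ lb , [] , r)
  step U (neg lb m (m′ ∷ ms) r)    = neg (m ∷ lb) m′ ms r
  step D (neg lb m ms r)           = neg (drop 1 lb) (headCount lb) (m ∷ ms) r

  profile : Word → Profile
  profile = foldr step (nonneg ([] , [] , []))

  level : Profile → ℤ
  level (nonneg (l , ms , r)) = + length ms
  level (neg lb m ms r)       = -[1+ length ms ]

  level-step-U : ∀ S → level (step U S) ≡ ℤ.suc (level S)
  level-step-U (nonneg _)             = refl
  level-step-U (neg lb m [] r)        = refl
  level-step-U (neg lb m (_ ∷ ms) r) = refl

  level-step-D : ∀ S → level (step D S) ≡ ℤ.pred (level S)
  level-step-D (nonneg (l , [] , r))     = refl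
  level-step-D (nonneg (l , _ ∷ ms , r)) = refl
  level-step-D (neg lb m ms r)           = refl

  level-profile : ∀ w → level (profile w) ≡ height w
  level-profile []      = refl
  level-profile (U ∷ w) = trans (level-step-U (profile w)) (trans (cong ℤ.suc (level-profile w)) (up (+ #U w) (+ #D w)))
    where
    up : ∀ u d → + 1 ℤ.+ (u ℤ.- d) ≡ (+ 1 ℤ.+ u) ℤ.- d
    up = ℤSolver.solve-∀
  level-profile (D ∷ w) = trans (level-step-D (profile w)) (trans (cong ℤ.pred (level-profile w)) (down (+ #U w) (+ #D w)))
    where
    down : ∀ u d → ℤ.- + 1 ℤ.+ (u ℤ.- d) ≡ u ℤ.- (+ 1 ℤ.+ d)
    down = ℤSolver.solve-∀

  sumSuc : List ℕ → ℕ
  sumSuc l = sum (map suc l)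

  size : Profile → ℕ
  size (nonneg (l , ms , r)) = sumSuc l + sum ms + sumSuc r
  size (neg lb m ms r)       = sumSuc lb + sumSuc (m ∷ ms) + sumSuc r

  headCount-drop : ∀ l → headCount l + sumSuc (drop 1 l) ≡ sumSuc l
  headCount-drop []      = refl
  headCount-drop (c ∷ l) = refl

  size-step-U : ∀ S → size (step U S) ≡ size S
  size-step-U (nonneg (l , ms , r)) =
    trans (rearrange (sumSuc l) (headCount r) (sum ms) (sumSuc (drop 1 r)))
          (cong (_+_ (sumSuc l + sum ms)) (headCount-drop r))
    where
    rearrange : ∀ a b c d → a + (b + c) + d ≡ a + c + (b + d)
    rearrange = ℕSolver.solve-∀
  size-step-U (neg lb m [] r) = rearrange (sumSuc lb) m (sumSuc r)
    where
    rearrange : ∀ a m c → suc m + a + 0 + c ≡ a + (suc m + 0) + c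
    rearrange = ℕSolver.solve-∀
  size-step-U (neg lb m (m′ ∷ ms) r) = rearrange (sumSuc lb) m m′ (sumSuc ms) (sumSuc r)
    where
    rearrange : ∀ a m m′ s c → suc m + a + (suc m′ + s) + c ≡ a + (suc m + (suc m′ + s)) + c
    rearrange = ℕSolver.solve-∀

  size-step-D : ∀ S → size (step D S) ≡ suc (size S)
  size-step-D (nonneg (l , [] , r)) =
    trans (rearrange (sumSuc (drop 1 l)) (headCount l) (sumSuc r))
          (cong (λ x → suc (x + 0 + sumSuc r)) (headCount-drop l))
    where
    rearrange : ∀ a b c → a + (suc b + 0) + c ≡ suc (b + a + 0 + c)
    rearrange = ℕSolver.solve-∀
  size-step-D (nonneg (l , m ∷ ms , r)) = rearrange (sumSuc l) (sum ms) m (sumSuc r)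
    where
    rearrange : ∀ a s m c → a + s + (suc m + c) ≡ suc (a + (m + s) + c)
    rearrange = ℕSolver.solve-∀
  size-step-D (neg lb m ms r) =
    trans (rearrange (sumSuc (drop 1 lb)) (headCount lb) (sumSuc (m ∷ ms)) (sumSuc r))
          (cong (λ x → suc (x + sumSuc (m ∷ ms) + sumSuc r)) (headCount-drop lb))
    where
    rearrange : ∀ a b s c → a + (suc b + s) + c ≡ suc (b + a + s + c)
    rearrange = ℕSolver.solve-∀

  size-profile : ∀ w → size (profile w) ≡ #D w
  size-profile []      = refl
  size-profile (U ∷ w) = trans (size-step-U (profile w)) (size-profile w)
  size-profile (D ∷ w) = trans (size-step-D (profile w)) (cong suc (size-profile w))

  countAt : List ℕ → ℕ → ℕ
  countAt []      j       = 0
  countAt (c ∷ l) zero    = suc c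
  countAt (c ∷ l) (suc j) = countAt l j

  -- Heights 1, …, length ms are looked up in ms; the entries passed on to
  -- the last argument are never read at position 0.
  multNonneg : List ℕ → List ℕ → List ℕ → ℤ → ℕ
  multNonneg l []       r (+ zero)  = countAt l 0
  multNonneg l []       r (+ suc j) = countAt r j
  multNonneg l []       r -[1+ j ]  = countAt l (suc j)
  multNonneg l (m ∷ ms) r h with h ℤ.≟ + suc (length ms)
  ... | yes _ = m
  ... | no  _ = multNonneg l ms (m ∷ r) h

  multNeg : List ℕ → ℕ → List ℕ → List ℕ → ℤ → ℕ
  multNeg lb m []        r = multNonneg (m ∷ lb) [] r
  multNeg lb m (m′ ∷ ms) r = multNeg (m ∷ lb) m′ ms r

  mult : Profile → ℤ → ℕ
  mult (nonneg (l , ms , r)) = multNonneg l ms r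
  mult (neg lb m ms r)       = multNeg lb m ms r

  countAt-0 : ∀ l → countAt l 0 ≡ headCount l
  countAt-0 []      = refl
  countAt-0 (c ∷ l) = refl

  countAt-drop : ∀ l j → countAt (drop 1 l) j ≡ countAt l (suc j)
  countAt-drop []      j = refl
  countAt-drop (c ∷ l) j = refl

  multNonneg-top : ∀ l m ms r → multNonneg l (m ∷ ms) r (+ suc (length ms)) ≡ m
  multNonneg-top l m ms r with + suc (length ms) ℤ.≟ + suc (length ms)
  ... | yes _  = refl
  ... | no  ne = contradiction refl ne

  multNonneg-notTop : ∀ l m ms r h → h ≢ + suc (length ms) → multNonneg l (m ∷ ms) r h ≡ multNonneg l ms (m ∷ r) h
  multNonneg-notTop l m ms r h ne with h ℤ.≟ + suc (length ms)
  ... | yes eq = contradiction eq ne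
  ... | no  _  = refl

  multNonneg-above : ∀ l ms r j → multNonneg l ms r (+ suc (length ms + j)) ≡ countAt r j
  multNonneg-above l []       r j = refl
  multNonneg-above l (m ∷ ms) r j = begin
    multNonneg l (m ∷ ms) r (+ suc (suc (length ms + j)))
      ≡⟨ multNonneg-notTop l m ms r _ (ℕP.m+1+n≢m (length ms) ∘ trans (ℕP.+-suc (length ms) j) ∘ ℕP.suc-injective ∘ ℤP.+-injective) ⟩
    multNonneg l ms (m ∷ r) (+ suc (suc (length ms + j)))
      ≡⟨ cong (λ z → multNonneg l ms (m ∷ r) (+ suc z)) (sym (ℕP.+-suc (length ms) j)) ⟩
    multNonneg l ms (m ∷ r) (+ suc (length ms + suc j))
      ≡⟨ multNonneg-above l ms (m ∷ r) (suc j) ⟩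
    countAt r j ∎
    where open ≡-Reasoning

  multNonneg-just-above : ∀ l ms r → multNonneg l ms r (+ suc (length ms)) ≡ countAt r 0
  multNonneg-just-above l ms r =
    trans (cong (λ z → multNonneg l ms r (+ suc z)) (sym (ℕP.+-identityʳ (length ms)))) (multNonneg-above l ms r 0)

  multNonneg-cong-above : ∀ l ms r r′ h → (∀ j → h ≡ + suc (length ms + j) → countAt r j ≡ countAt r′ j) →
                          multNonneg l ms r h ≡ multNonneg l ms r′ h
  multNonneg-cong-above l []       r r′ (+ zero)  r≈r′ = refl
  multNonneg-cong-above l []       r r′ (+ suc j) r≈r′ = r≈r′ j refl
  multNonneg-cong-above l []       r r′ -[1+ j ]  r≈r′ = refl
  multNonneg-cong-above l (m ∷ ms) r r′ h         r≈r′ with h ℤ.≟ + suc (length ms)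
  ... | yes _ = refl
  ... | no  _ = multNonneg-cong-above l ms (m ∷ r) (m ∷ r′) h m∷r≈m∷r′
    where
    m∷r≈m∷r′ : ∀ j → h ≡ + suc (length ms + j) → countAt (m ∷ r) j ≡ countAt (m ∷ r′) j
    m∷r≈m∷r′ zero    _  = refl
    m∷r≈m∷r′ (suc j) eq = r≈r′ j (trans eq (cong (+_ ∘ suc) (ℕP.+-suc (length ms) j)))

  mult-step-U : ∀ S h → mult (step U S) h ≡ mult S h
  mult-step-U (nonneg (l , ms , r)) h with h ℤ.≟ + suc (length ms)
  ... | yes refl = sym (trans (multNonneg-just-above l ms r) (countAt-0 r))
  ... | no  ne   = multNonneg-cong-above l ms (headCount r ∷ drop 1 r) r h unfold
    where
    unfold : ∀ j → h ≡ + suc (length ms + j) → countAt (headCount r ∷ drop 1 r) j ≡ countAt r j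
    unfold zero    eq = contradiction (trans eq (cong (+_ ∘ suc) (ℕP.+-identityʳ (length ms)))) ne
    unfold (suc j) eq = countAt-drop r j
  mult-step-U (neg lb m [] r)        h = refl
  mult-step-U (neg lb m (_ ∷ ms) r) h = refl

  δ-negsuc : ∀ j k → δ -[1+ suc j ] -[1+ suc k ] ≡ δ -[1+ j ] -[1+ k ]
  δ-negsuc j k with -[1+ suc k ] ℤ.≟ -[1+ suc j ] | -[1+ k ] ℤ.≟ -[1+ j ]
  ... | yes _    | yes _  = refl
  ... | no  _    | no  _  = refl
  ... | yes refl | no ne  = contradiction refl ne
  ... | no ne    | yes refl = contradiction refl ne

  countAt-bump : ∀ xs lb j → countAt (xs ++ headCount lb ∷ drop 1 lb) j ≡ δ -[1+ j ] -[1+ length xs ] + countAt (xs ++ lb) j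
  countAt-bump []       lb zero    = cong suc (sym (countAt-0 lb))
  countAt-bump []       lb (suc j) = countAt-drop lb j
  countAt-bump (x ∷ xs) lb zero    = refl
  countAt-bump (x ∷ xs) lb (suc j) = trans (countAt-bump xs lb j) (cong (_+ countAt (xs ++ lb) j) (sym (δ-negsuc j (length xs))))

  multNeg-bump : ∀ ms xs lb m r h → multNeg (xs ++ headCount lb ∷ drop 1 lb) m ms r h
                                    ≡ δ h -[1+ length ms + length xs ] + multNeg (xs ++ lb) m ms r h
  multNeg-bump []        xs lb m r (+ zero)  = cong (_+ suc m) (sym (δ-≢ (+ 0) -[1+ length xs ] (λ ())))
  multNeg-bump []        xs lb m r (+ suc j) = cong (_+ countAt r j) (sym (δ-≢ (+ suc j) -[1+ length xs ] (λ ())))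
  multNeg-bump []        xs lb m r -[1+ j ]  = countAt-bump xs lb j
  multNeg-bump (m′ ∷ ms) xs lb m r h =
    trans (multNeg-bump ms (m ∷ xs) lb m′ r h)
          (cong (λ z → δ h -[1+ z ] + multNeg (m ∷ xs ++ lb) m′ ms r h) (ℕP.+-suc (length ms) (length xs)))

  mult-step-D : ∀ S h → mult (step D S) h ≡ δ h (level S) + mult S h
  mult-step-D (nonneg (l , [] , r))     (+ zero)  = cong suc (sym (countAt-0 l))
  mult-step-D (nonneg (l , [] , r))     (+ suc j) = cong (_+ countAt r j) (sym (δ-≢ (+ suc j) (+ 0) (λ ())))
  mult-step-D (nonneg (l , [] , r))     -[1+ j ]  =
    trans (countAt-drop l j) (cong (_+ countAt l (suc j)) (sym (δ-≢ -[1+ j ] (+ 0) (λ ()))))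
  mult-step-D (nonneg (l , m ∷ ms , r)) h with h ℤ.≟ + suc (length ms)
  ... | yes refl = trans (multNonneg-just-above l ms (m ∷ r)) (cong (_+ m) (sym (δ-refl (+ suc (length ms)))))
  ... | no  ne   = cong (_+ multNonneg l ms (m ∷ r) h) (sym (δ-≢ h _ (ne ∘ sym)))
  mult-step-D (neg lb m ms r)           h =
    trans (multNeg-bump ms [] lb m r h) (cong (λ z → δ h -[1+ z ] + multNeg lb m ms r h) (ℕP.+-identityʳ (length ms)))

  multiplicity-profile : ∀ w h → multiplicity h (heights w) ≡ mult (profile w) h
  multiplicity-profile []      (+ zero)  = refl
  multiplicity-profile []      (+ suc j) = refl
  multiplicity-profile []      -[1+ j ]  = refl
  multiplicity-profile (U ∷ w) h = trans (multiplicity-profile w h) (sym (mult-step-U (profile w) h))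
  multiplicity-profile (D ∷ w) h =
    trans (cong₂ _+_ (cong (δ h) (sym (level-profile w))) (multiplicity-profile w h)) (sym (mult-step-D (profile w) h))

  countAt-injective : ∀ l l′ → (∀ j → countAt l j ≡ countAt l′ j) → l ≡ l′
  countAt-injective []      []        eq = refl
  countAt-injective []      (_ ∷ _)   eq = contradiction (eq 0) (λ ())
  countAt-injective (_ ∷ _) []        eq = contradiction (eq 0) (λ ())
  countAt-injective (c ∷ l) (c′ ∷ l′) eq = cong₂ _∷_ (ℕP.suc-injective (eq 0)) (countAt-injective l l′ (eq ∘ suc))

  multNonneg-injective : ∀ l ms r l′ ms′ r′ → length ms ≡ length ms′ →
                         (∀ h → multNonneg l ms r h ≡ multNonneg l′ ms′ r′ h) → (l , ms , r) ≡ (l′ , ms′ , r′)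
  multNonneg-injective l [] r l′ [] r′ _ eq =
    cong₂ (λ a b → a , [] , b) (countAt-injective l l′ low) (countAt-injective r r′ (eq ∘ +_ ∘ suc))
    where
    low : ∀ j → countAt l j ≡ countAt l′ j
    low zero    = eq (+ 0)
    low (suc j) = eq -[1+ j ]
  multNonneg-injective l (m ∷ ms) r l′ (m′ ∷ ms′) r′ len eq with top-≡
    where
    open ≡-Reasoning
    top-≡ : m ≡ m′
    top-≡ = begin
      m                                                ≡⟨ sym (multNonneg-top l m ms r) ⟩
      multNonneg l (m ∷ ms) r (+ suc (length ms))      ≡⟨ eq (+ suc (length ms)) ⟩
      multNonneg l′ (m′ ∷ ms′) r′ (+ suc (length ms))  ≡⟨ cong (multNonneg l′ (m′ ∷ ms′) r′ ∘ +_ ∘ suc) (ℕP.suc-injective len) ⟩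
      multNonneg l′ (m′ ∷ ms′) r′ (+ suc (length ms′)) ≡⟨ multNonneg-top l′ m′ ms′ r′ ⟩
      m′                                               ∎
  ... | refl with multNonneg-injective l ms (m ∷ r) l′ ms′ (m ∷ r′) (ℕP.suc-injective len) below
    where
    below : ∀ h → multNonneg l ms (m ∷ r) h ≡ multNonneg l′ ms′ (m ∷ r′) h
    below h with h ℤ.≟ + suc (length ms)
    ... | yes refl = trans (multNonneg-just-above l ms (m ∷ r))
                           (sym (trans (cong (multNonneg l′ ms′ (m ∷ r′) ∘ +_ ∘ suc) (ℕP.suc-injective len))
                                       (multNonneg-just-above l′ ms′ (m ∷ r′))))
    ... | no  ne   = trans (sym (multNonneg-notTop l m ms r h ne))
                           (trans (eq h) (multNonneg-notTop l′ m ms′ r′ h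
                                            (ne ∘ flip trans (cong (+_ ∘ suc) (sym (ℕP.suc-injective len))))))
  ...   | refl = refl

  repeat : ℕ → Word → Word
  repeat n w = concat (replicate n w)

  lowWord highWord midWord : List ℕ → Word
  lowWord  []       = []
  lowWord  (c ∷ l)  = repeat c (U ∷ D ∷ []) ++ U ∷ lowWord l ++ D ∷ []
  highWord []       = []
  highWord (c ∷ r)  = repeat c (D ∷ U ∷ []) ++ D ∷ highWord r ++ U ∷ []
  midWord  []       = []
  midWord  (m ∷ ms) = U ∷ repeat m (D ∷ U ∷ []) ++ midWord ms

  tripleWord : Triple → Word
  tripleWord (l , ms , r) = highWord r ++ midWord ms ++ lowWord l

  run : Word → Profile → Profile
  run w S = foldr step S w

  run-++ : ∀ u v S → run (u ++ v) S ≡ run u (run v S)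
  run-++ u v S = ListP.foldr-++ step S u v

  run-UD-nonneg : ∀ c x l r → run (repeat c (U ∷ D ∷ [])) (nonneg (x ∷ l , [] , r)) ≡ nonneg (c + x ∷ l , [] , r)
  run-UD-nonneg zero    x l r = refl
  run-UD-nonneg (suc c) x l r = cong (step U ∘ step D) (run-UD-nonneg c x l r)

  run-UD-neg : ∀ c x lb m ms r → run (repeat c (U ∷ D ∷ [])) (neg (x ∷ lb) m ms r) ≡ neg (c + x ∷ lb) m ms r
  run-UD-neg zero    x lb m ms r = refl
  run-UD-neg (suc c) x lb m ms r = cong (step U ∘ step D) (run-UD-neg c x lb m ms r)

  run-DU : ∀ c x l ms r → run (repeat c (D ∷ U ∷ [])) (nonneg (l , ms , x ∷ r)) ≡ nonneg (l , ms , c + x ∷ r)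
  run-DU zero    x l ms r = refl
  run-DU (suc c) x l ms r = cong (step D ∘ step U) (run-DU c x l ms r)

  run-lowWord-neg : ∀ l m ms r → run (lowWord l) (neg [] m ms r) ≡ neg l m ms r
  run-lowWord-neg []      m ms r = refl
  run-lowWord-neg (c ∷ l) m ms r = begin
    run (repeat c (U ∷ D ∷ []) ++ U ∷ lowWord l ++ D ∷ []) (neg [] m ms r)
      ≡⟨ run-++ (repeat c (U ∷ D ∷ [])) _ _ ⟩
    run (repeat c (U ∷ D ∷ [])) (step U (run (lowWord l ++ D ∷ []) (neg [] m ms r)))
      ≡⟨ cong (run (repeat c (U ∷ D ∷ [])) ∘ step U)
              (trans (run-++ (lowWord l) (D ∷ []) _) (run-lowWord-neg l 0 (m ∷ ms) r)) ⟩
    run (repeat c (U ∷ D ∷ [])) (neg (0 ∷ l) m ms r)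
      ≡⟨ run-UD-neg c 0 l m ms r ⟩
    neg (c + 0 ∷ l) m ms r
      ≡⟨ cong (λ x → neg (x ∷ l) m ms r) (ℕP.+-identityʳ c) ⟩
    neg (c ∷ l) m ms r ∎
    where open ≡-Reasoning

  run-lowWord : ∀ l r → run (lowWord l) (nonneg ([] , [] , r)) ≡ nonneg (l , [] , r)
  run-lowWord []      r = refl
  run-lowWord (c ∷ l) r = begin
    run (repeat c (U ∷ D ∷ []) ++ U ∷ lowWord l ++ D ∷ []) (nonneg ([] , [] , r))
      ≡⟨ run-++ (repeat c (U ∷ D ∷ [])) _ _ ⟩
    run (repeat c (U ∷ D ∷ [])) (step U (run (lowWord l ++ D ∷ []) (nonneg ([] , [] , r))))
      ≡⟨ cong (run (repeat c (U ∷ D ∷ [])) ∘ step U)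
              (trans (run-++ (lowWord l) (D ∷ []) _) (run-lowWord-neg l 0 [] r)) ⟩
    run (repeat c (U ∷ D ∷ [])) (nonneg (0 ∷ l , [] , r))
      ≡⟨ run-UD-nonneg c 0 l r ⟩
    nonneg (c + 0 ∷ l , [] , r)
      ≡⟨ cong (λ x → nonneg (x ∷ l , [] , r)) (ℕP.+-identityʳ c) ⟩
    nonneg (c ∷ l , [] , r) ∎
    where open ≡-Reasoning

  run-highWord : ∀ r l ms → run (highWord r) (nonneg (l , ms , [])) ≡ nonneg (l , ms , r)
  run-highWord []      l ms = refl
  run-highWord (c ∷ r) l ms = begin
    run (repeat c (D ∷ U ∷ []) ++ D ∷ highWord r ++ U ∷ []) (nonneg (l , ms , []))
      ≡⟨ run-++ (repeat c (D ∷ U ∷ [])) _ _ ⟩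
    run (repeat c (D ∷ U ∷ [])) (step D (run (highWord r ++ U ∷ []) (nonneg (l , ms , []))))
      ≡⟨ cong (run (repeat c (D ∷ U ∷ [])) ∘ step D)
              (trans (run-++ (highWord r) (U ∷ []) _) (run-highWord r l (0 ∷ ms))) ⟩
    run (repeat c (D ∷ U ∷ [])) (nonneg (l , ms , 0 ∷ r))
      ≡⟨ run-DU c 0 l ms r ⟩
    nonneg (l , ms , c + 0 ∷ r)
      ≡⟨ cong (λ x → nonneg (l , ms , x ∷ r)) (ℕP.+-identityʳ c) ⟩
    nonneg (l , ms , c ∷ r) ∎
    where open ≡-Reasoning

  run-DU-fresh : ∀ m l ms → run (repeat (suc m) (D ∷ U ∷ [])) (nonneg (l , ms , [])) ≡ nonneg (l , ms , m ∷ [])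
  run-DU-fresh zero    l ms = refl
  run-DU-fresh (suc m) l ms = cong (step D ∘ step U) (run-DU-fresh m l ms)

  run-midWord : ∀ ms l → run (midWord ms) (nonneg (l , [] , [])) ≡ nonneg (l , ms , [])
  run-midWord []       l = refl
  run-midWord (m ∷ ms) l =
    trans (cong (step U) (trans (run-++ (repeat m (D ∷ U ∷ [])) (midWord ms) _)
                                (cong (run (repeat m (D ∷ U ∷ []))) (run-midWord ms l))))
          (push m)
    where
    push : ∀ m → step U (run (repeat m (D ∷ U ∷ [])) (nonneg (l , ms , []))) ≡ nonneg (l , m ∷ ms , [])
    push zero    = refl
    push (suc m) = cong (step U) (run-DU-fresh m l ms)

  profile-tripleWord : ∀ t → profile (tripleWord t) ≡ nonneg t
  profile-tripleWord (l , ms , r) = begin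
    run (highWord r ++ midWord ms ++ lowWord l) (nonneg ([] , [] , []))
      ≡⟨ run-++ (highWord r) _ _ ⟩
    run (highWord r) (run (midWord ms ++ lowWord l) (nonneg ([] , [] , [])))
      ≡⟨ cong (run (highWord r)) (run-++ (midWord ms) (lowWord l) _) ⟩
    run (highWord r) (run (midWord ms) (run (lowWord l) (nonneg ([] , [] , []))))
      ≡⟨ cong (run (highWord r) ∘ run (midWord ms)) (run-lowWord l []) ⟩
    run (highWord r) (run (midWord ms) (nonneg (l , [] , [])))
      ≡⟨ cong (run (highWord r)) (run-midWord ms l) ⟩
    run (highWord r) (nonneg (l , ms , []))
      ≡⟨ run-highWord r l ms ⟩
    nonneg (l , ms , r) ∎
    where open ≡-Reasoning

open Profiles

module Enumeration where
  open import Data.Nat as ℕ using (ℕ; zero; suc; _+_)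
  import Data.Nat.Properties as ℕP
  import Data.Nat.Tactic.RingSolver as ℕSolver
  import Data.Integer as ℤ
  import Data.Integer.Properties as ℤP
  open import Data.List using (List; []; _∷_; _++_; length; map)
  open import Data.Nat.ListAction using (sum)
  import Data.List.Properties as ListP
  open import Data.List.Membership.Propositional using (_∈_)
  open import Data.List.Membership.Propositional.Properties using (∈-map⁺; ∈-map⁻; ∈-++⁺ˡ; ∈-++⁺ʳ)
  open import Data.List.Relation.Unary.All as All using (All; []; _∷_)
  import Data.List.Relation.Unary.All.Properties as AllP
  open import Data.List.Relation.Unary.Any as Any using (here)
  open import Data.List.Relation.Unary.AllPairs using (AllPairs; []; _∷_)
  import Data.List.Relation.Unary.AllPairs.Properties as AllPairsP
  open import Data.List.Relation.Unary.Unique.Propositional using (Unique)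
  import Data.List.Relation.Unary.Unique.Propositional.Properties as UniqueP
  open import Data.List.Relation.Binary.Disjoint.Propositional using (Disjoint)
  open import Data.Product using (∃; _×_; _,_; proj₁; proj₂)
  open import Function using (_∘_)
  open import Relation.Binary.PropositionalEquality
  open import Relation.Nullary using (contradiction)

  incHead : List ℕ → List ℕ
  incHead []      = []
  incHead (c ∷ l) = suc c ∷ l

  onMid onHigh : (List ℕ → List ℕ) → Triple → Triple
  onMid  f (l , ms , r) = l , f ms , r
  onHigh f (l , ms , r) = l , ms , f r

  mid high : Triple → List ℕ
  mid  (l , ms , r) = ms
  high (l , ms , r) = r

  flat : List ℕ → Triple
  flat l = l , [] , []

  weight : Triple → ℕ
  weight t = size (nonneg t)

  -- The compositions of d + 1, each part lowered by one.
  compositions⁺ : ℕ → List (List ℕ)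
  compositions⁺ zero    = (0 ∷ []) ∷ []
  compositions⁺ (suc d) = map (0 ∷_) (compositions⁺ d) ++ map incHead (compositions⁺ d)

  compositions : ℕ → List (List ℕ)
  compositions zero    = [] ∷ []
  compositions (suc d) = compositions⁺ d

  mutual
    flatTriples : ℕ → List Triple
    flatTriples d = map flat (compositions d) ++ highTriples d

    highTriples : ℕ → List Triple
    highTriples zero    = []
    highTriples (suc d) = map (onHigh (0 ∷_)) (flatTriples d) ++ map (onHigh incHead) (highTriples d)

  triples : ℕ → ℕ → List Triple
  triples zero    d       = flatTriples d
  triples (suc e) zero    = map (onMid (0 ∷_)) (triples e zero)
  triples (suc e) (suc d) = map (onMid (0 ∷_)) (triples e (suc d)) ++ map (onMid incHead) (triples (suc e) d)

  Valid : ℕ → ℕ → Triple → Set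
  Valid e d t = length (mid t) ≡ e × weight t ≡ d

  weight-onHigh : ∀ f t → sumSuc (f (high t)) ≡ suc (sumSuc (high t)) → weight (onHigh f t) ≡ suc (weight t)
  weight-onHigh f (l , ms , r) eq =
    trans (cong (_+_ (sumSuc l + sum ms)) eq) (ℕP.+-suc (sumSuc l + sum ms) (sumSuc r))

  weight-onMid : ∀ f t → sum (f (mid t)) ≡ suc (sum (mid t)) → weight (onMid f t) ≡ suc (weight t)
  weight-onMid f (l , ms , r) eq =
    trans (cong (λ s → sumSuc l + s + sumSuc r) eq) (shift (sumSuc l) (sum ms) (sumSuc r))
    where
    shift : ∀ a s c → a + suc s + c ≡ suc (a + s + c)
    shift = ℕSolver.solve-∀

  compositions⁺-valid : ∀ d → All (λ l → sumSuc l ≡ suc d) (compositions⁺ d)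
  compositions⁺-valid zero    = refl ∷ []
  compositions⁺-valid (suc d) =
    AllP.++⁺ (AllP.map⁺ (All.map (cong suc) (compositions⁺-valid d)))
             (AllP.map⁺ (All.map (λ {l} → incHead-valid l) (compositions⁺-valid d)))
    where
    incHead-valid : ∀ l → sumSuc l ≡ suc d → sumSuc (incHead l) ≡ suc (suc d)
    incHead-valid (c ∷ l) eq = cong suc eq

  compositions-valid : ∀ d → All (λ l → sumSuc l ≡ d) (compositions d)
  compositions-valid zero    = refl ∷ []
  compositions-valid (suc d) = compositions⁺-valid d

  HighValid : ℕ → Triple → Set
  HighValid d t = Valid 0 d t × high t ≢ []

  mutual
    flatTriples-valid : ∀ d → All (Valid 0 d) (flatTriples d)
    flatTriples-valid d =
      AllP.++⁺ (AllP.map⁺ (All.map (λ {l} → flat-valid l) (compositions-valid d))) (All.map proj₁ (highTriples-valid d))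
      where
      flat-valid : ∀ l → sumSuc l ≡ d → Valid 0 d (flat l)
      flat-valid l eq = refl , trans (ℕP.+-identityʳ _) (trans (ℕP.+-identityʳ _) eq)

    highTriples-valid : ∀ d → All (HighValid d) (highTriples d)
    highTriples-valid zero    = []
    highTriples-valid (suc d) =
      AllP.++⁺ (AllP.map⁺ (All.map (λ {t} → new-valid t) (flatTriples-valid d)))
               (AllP.map⁺ (All.map (λ {t} → inc-valid t) (highTriples-valid d)))
      where
      new-valid : ∀ t → Valid 0 d t → HighValid (suc d) (onHigh (0 ∷_) t)
      new-valid t (len , w) = (len , trans (weight-onHigh (0 ∷_) t refl) (cong suc w)) , λ ()
      inc-valid : ∀ t → HighValid d t → HighValid (suc d) (onHigh incHead t)
      inc-valid (l , ms , [])      (_ , []≢[])     = contradiction refl []≢[]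
      inc-valid t@(_ , _ , _ ∷ _) ((len , w) , _) = (len , trans (weight-onHigh incHead t refl) (cong suc w)) , λ ()

  push-valid : ∀ {e d} t → Valid e d t → Valid (suc e) d (onMid (0 ∷_) t)
  push-valid (l , ms , r) (len , w) = cong suc len , w

  incTop-valid : ∀ {e d} t → Valid (suc e) d t → Valid (suc e) (suc d) (onMid incHead t)
  incTop-valid t@(l , m ∷ ms , r) (len , w) = len , trans (weight-onMid incHead t refl) (cong suc w)

  triples-valid : ∀ e d → All (Valid e d) (triples e d)
  triples-valid zero    d       = flatTriples-valid d
  triples-valid (suc e) zero    = AllP.map⁺ (All.map (λ {t} → push-valid t) (triples-valid e zero))
  triples-valid (suc e) (suc d) =
    AllP.++⁺ (AllP.map⁺ (All.map (λ {t} → push-valid t) (triples-valid e (suc d))))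
             (AllP.map⁺ (All.map (λ {t} → incTop-valid t) (triples-valid (suc e) d)))

  incHead-injective : ∀ {x y} → incHead x ≡ incHead y → x ≡ y
  incHead-injective {[]}    {[]}    _    = refl
  incHead-injective {_ ∷ _} {_ ∷ _} refl = refl

  0∷≢incHead : ∀ x y → 0 ∷ x ≢ incHead y
  0∷≢incHead x (c ∷ y) ()

  onMid-injective : ∀ {f} → (∀ {x y} → f x ≡ f y → x ≡ y) → ∀ {t t′} → onMid f t ≡ onMid f t′ → t ≡ t′
  onMid-injective f-inj {l , ms , r} {l′ , ms′ , r′} eq = cong₂ (λ a (b , c) → a , b , c) (cong proj₁ eq)
    (cong₂ _,_ (f-inj (cong mid eq)) (cong high eq))

  onHigh-injective : ∀ {f} → (∀ {x y} → f x ≡ f y → x ≡ y) → ∀ {t t′} → onHigh f t ≡ onHigh f t′ → t ≡ t′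
  onHigh-injective f-inj {l , ms , r} {l′ , ms′ , r′} eq = cong₂ (λ a (b , c) → a , b , c) (cong proj₁ eq)
    (cong₂ _,_ (cong mid eq) (f-inj (cong high eq)))

  disjoint-map : ∀ {A B : Set} {f g : A → B} {xs ys} → (∀ x y → f x ≢ g y) → Disjoint (map f xs) (map g ys)
  disjoint-map {f = f} {g} f≢g (v∈fxs , v∈gys) with ∈-map⁻ f v∈fxs | ∈-map⁻ g v∈gys
  ... | x , _ , refl | y , _ , eq = f≢g x y eq

  compositions⁺-unique : ∀ d → Unique (compositions⁺ d)
  compositions⁺-unique zero    = [] ∷ []
  compositions⁺-unique (suc d) =
    UniqueP.++⁺ (UniqueP.map⁺ (proj₂ ∘ ListP.∷-injective) (compositions⁺-unique d))
                (UniqueP.map⁺ incHead-injective (compositions⁺-unique d))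
                (disjoint-map 0∷≢incHead)

  compositions-unique : ∀ d → Unique (compositions d)
  compositions-unique zero    = [] ∷ []
  compositions-unique (suc d) = compositions⁺-unique d

  mutual
    flatTriples-unique : ∀ d → Unique (flatTriples d)
    flatTriples-unique d =
      UniqueP.++⁺ (UniqueP.map⁺ (cong proj₁) (compositions-unique d)) (highTriples-unique d) flat∉high
      where
      flat∉high : Disjoint (map flat (compositions d)) (highTriples d)
      flat∉high (v∈flat , v∈high) with ∈-map⁻ flat v∈flat
      ... | l , _ , refl = proj₂ (All.lookup (highTriples-valid d) v∈high) refl

    highTriples-unique : ∀ d → Unique (highTriples d)
    highTriples-unique zero    = []
    highTriples-unique (suc d) =
      UniqueP.++⁺ (UniqueP.map⁺ (onHigh-injective (proj₂ ∘ ListP.∷-injective)) (flatTriples-unique d))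
                  (UniqueP.map⁺ (onHigh-injective incHead-injective) (highTriples-unique d))
                  (disjoint-map λ t t′ → 0∷≢incHead (high t) (high t′) ∘ cong high)

  triples-unique : ∀ e d → Unique (triples e d)
  triples-unique zero    d       = flatTriples-unique d
  triples-unique (suc e) zero    = UniqueP.map⁺ (onMid-injective (proj₂ ∘ ListP.∷-injective)) (triples-unique e zero)
  triples-unique (suc e) (suc d) =
    UniqueP.++⁺ (UniqueP.map⁺ (onMid-injective (proj₂ ∘ ListP.∷-injective)) (triples-unique e (suc d)))
                (UniqueP.map⁺ (onMid-injective incHead-injective) (triples-unique (suc e) d))
                (disjoint-map λ t t′ → 0∷≢incHead (mid t) (mid t′) ∘ cong mid)

  ∈-compositions⁺ : ∀ c l → c ∷ l ∈ compositions⁺ (c + sumSuc l)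
  ∈-compositions⁺ zero    []       = here refl
  ∈-compositions⁺ zero    (c ∷ l)  = ∈-++⁺ˡ (∈-map⁺ (0 ∷_) (∈-compositions⁺ c l))
  ∈-compositions⁺ (suc c) l        = ∈-++⁺ʳ _ (∈-map⁺ incHead (∈-compositions⁺ c l))

  ∈-compositions : ∀ l → l ∈ compositions (sumSuc l)
  ∈-compositions []      = here refl
  ∈-compositions (c ∷ l) = ∈-compositions⁺ c l

  mutual
    ∈-flatTriples : ∀ l r → (l , [] , r) ∈ flatTriples (weight (l , [] , r))
    ∈-flatTriples l []      =
      subst (λ d → flat l ∈ flatTriples d) (sym (trans (ℕP.+-identityʳ (sumSuc l + 0)) (ℕP.+-identityʳ (sumSuc l))))
            (∈-++⁺ˡ (∈-map⁺ flat (∈-compositions l)))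
    ∈-flatTriples l (c ∷ r) = ∈-++⁺ʳ _ (∈-highTriples l c r)

    ∈-highTriples : ∀ l c r → (l , [] , c ∷ r) ∈ highTriples (weight (l , [] , c ∷ r))
    ∈-highTriples l zero    r =
      subst (λ d → (l , [] , 0 ∷ r) ∈ highTriples d) (sym (weight-onHigh (0 ∷_) (l , [] , r) refl))
            (∈-++⁺ˡ (∈-map⁺ (onHigh (0 ∷_)) (∈-flatTriples l r)))
    ∈-highTriples l (suc c) r =
      subst (λ d → (l , [] , suc c ∷ r) ∈ highTriples d) (sym (weight-onHigh incHead (l , [] , c ∷ r) refl))
            (∈-++⁺ʳ _ (∈-map⁺ (onHigh incHead) (∈-highTriples l c r)))

  ∈-push : ∀ e d {t} → t ∈ triples e d → onMid (0 ∷_) t ∈ triples (suc e) d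
  ∈-push e zero    t∈ = ∈-map⁺ (onMid (0 ∷_)) t∈
  ∈-push e (suc d) t∈ = ∈-++⁺ˡ (∈-map⁺ (onMid (0 ∷_)) t∈)

  ∈-triples : ∀ t → t ∈ triples (length (mid t)) (weight t)
  ∈-triples (l , []           , r) = ∈-flatTriples l r
  ∈-triples (l , zero  ∷ ms , r) = ∈-push (length ms) (weight (l , ms , r)) (∈-triples (l , ms , r))
  ∈-triples (l , suc m ∷ ms , r) =
    subst (λ d → (l , suc m ∷ ms , r) ∈ triples (suc (length ms)) d) (sym (weight-onMid incHead (l , m ∷ ms , r) refl))
          (∈-++⁺ʳ (map (onMid (0 ∷_)) (triples (length ms) (suc (weight (l , m ∷ ms , r)))))
                  (∈-map⁺ (onMid incHead) (∈-triples (l , m ∷ ms , r))))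

  triples-complete : ∀ {e d} t → Valid e d t → t ∈ triples e d
  triples-complete t (refl , refl) = ∈-triples t

  allPairs-restrict : ∀ {A : Set} {P : A → Set} {R S : A → A → Set} {xs} →
                      (∀ {x y} → P x → P y → R x y → S x y) → All P xs → AllPairs R xs → AllPairs S xs
  allPairs-restrict f []         []         = []
  allPairs-restrict f (px ∷ pxs) (rx ∷ rxs) = All.zipWith (λ (py , r) → f px py r) (pxs , rx) ∷ allPairs-restrict f pxs rxs

  module _ {n k e : ℕ} (n≡ : e + k + k ≡ n) where

    #U-InS : ∀ w → InS n k w → #U w ≡ e + k
    #U-InS w (len , #D≡) = ℕP.+-cancelʳ-≡ k _ _ (trans (cong (#U w +_) (sym #D≡)) (trans (#U+#D w) (trans len (sym n≡))))

    height-InS : ∀ w → InS n k w → height w ≡ ℤ.+ e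
    height-InS w w∈@(_ , #D≡) = height-≡ w e (trans (#U-InS w w∈) (cong (e +_) (sym #D≡)))

    InS-tripleWord : ∀ t → Valid e k t → InS n k (tripleWord t)
    InS-tripleWord t (len , w≡) = trans (sym (#U+#D (tripleWord t))) (trans (cong₂ _+_ #U≡ #D≡) n≡) , #D≡
      where
      #D≡ : #D (tripleWord t) ≡ k
      #D≡ = trans (sym (size-profile (tripleWord t))) (trans (cong size (profile-tripleWord t)) w≡)
      #U≡ : #U (tripleWord t) ≡ e + k
      #U≡ = trans (height-≡⁻ (tripleWord t) e (trans (sym (level-profile (tripleWord t)))
                                                (trans (cong level (profile-tripleWord t)) (cong ℤ.+_ len))))
                  (cong (e +_) #D≡)

    private
      sameLetters : ∀ u v → InS n k u → InS n k v → #U u ≡ #U v × #D u ≡ #D v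
      sameLetters u v u∈ v∈ = trans (#U-InS u u∈) (sym (#U-InS v v∈)) , trans (proj₂ u∈) (sym (proj₂ v∈))

      multiplicity-tripleWord : ∀ t h → multiplicity h (heights (tripleWord t)) ≡ mult (nonneg t) h
      multiplicity-tripleWord t h = trans (multiplicity-profile (tripleWord t) h) (cong (λ S → mult S h) (profile-tripleWord t))

    tripleWord-separates : ∀ {t t′} → Valid e k t → Valid e k t′ → WeylEq (tripleWord t) (tripleWord t′) → t ≡ t′
    tripleWord-separates {t@(l , ms , r)} {t′@(l′ , ms′ , r′)} t✓ t′✓ t≈t′ =
      multNonneg-injective l ms r l′ ms′ r′ (trans (proj₁ t✓) (sym (proj₁ t′✓))) λ h →
        trans (sym (multiplicity-tripleWord t h))
              (trans (weylEq⇒≈ₘ (tripleWord t) (tripleWord t′) (proj₁ same) (proj₂ same) t≈t′ h)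
                     (multiplicity-tripleWord t′ h))
      where
      same = sameLetters (tripleWord t) (tripleWord t′) (InS-tripleWord t t✓) (InS-tripleWord t′ t′✓)

    tripleWord-complete : ∀ w → InS n k w → ∃ λ t → t ∈ triples e k × WeylEq w (tripleWord t)
    tripleWord-complete w w∈ with profile w in eq
    ... | neg lb m ms r = contradiction (trans (sym (cong level eq)) (trans (level-profile w) (height-InS w w∈))) λ ()
    ... | nonneg t = t , triples-complete t (len , wt) , ≈ₘ⇒weylEq w (tripleWord t) (proj₁ same) (proj₂ same) λ h →
      trans (multiplicity-profile w h) (trans (cong (λ S → mult S h) eq) (sym (multiplicity-tripleWord t h)))
      where
      len : length (mid t) ≡ e
      len = ℤP.+-injective (trans (sym (cong level eq)) (trans (level-profile w) (height-InS w w∈)))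
      wt : weight t ≡ k
      wt = trans (sym (cong size eq)) (trans (size-profile w) (proj₂ w∈))
      same = sameLetters w (tripleWord t) w∈ (InS-tripleWord t (len , wt))

    numClasses-triples : NumClasses n k (length (triples e k))
    numClasses-triples =
      map tripleWord (triples e k) ,
      ListP.length-map tripleWord (triples e k) ,
      AllP.map⁺ (All.map (λ {t} → InS-tripleWord t) (triples-valid e k)) ,
      AllPairsP.map⁺ (allPairs-restrict (λ t✓ t′✓ t≢t′ → t≢t′ ∘ tripleWord-separates t✓ t′✓)
                                        (triples-valid e k) (triples-unique e k)) ,
      λ w w∈ → let t , t∈ , w≈t = tripleWord-complete w w∈ in Any.map (λ { refl → w≈t }) (∈-map⁺ tripleWord t∈)

open Enumeration

module Counting where
  open import Data.Nat as ℕ using (ℕ; zero; suc; _+_; _*_; _∸_; _^_; _≤_; _≤?_)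
  import Data.Nat.Properties as ℕP
  import Data.Nat.Tactic.RingSolver as ℕSolver
  open import Data.List using (_∷_; _++_; length; map)
  import Data.List.Properties as ListP
  open import Data.Product using (_×_; _,_; proj₁; proj₂)
  open import Relation.Binary.PropositionalEquality
  open import Relation.Nullary using (¬_; yes; no)

  tripleCount : ℕ → ℕ → ℕ
  tripleCount e d = length (triples e d)

  classCount : ℕ → ℕ → ℕ
  classCount n k with 2 * k ≤? n
  ... | yes _ = tripleCount (n ∸ 2 * k) k
  ... | no  _ = tripleCount (n ∸ 2 * (n ∸ k)) (n ∸ k)

  ∸-2*-+ : ∀ n m → 2 * m ≤ n → n ∸ 2 * m + m + m ≡ n
  ∸-2*-+ n m 2m≤n = trans (ℕP.+-assoc (n ∸ 2 * m) m m)
                              (trans (cong (n ∸ 2 * m +_) (sym (cong (m +_) (ℕP.+-identityʳ m)))) (ℕP.m∸n+n≡m 2m≤n))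

  2*-∸-≤ : ∀ {n k} → k ≤ n → ¬ (2 * k ≤ n) → 2 * (n ∸ k) ≤ n
  2*-∸-≤ {n} {k} k≤n 2k≰n = begin
    2 * (n ∸ k)          ≡⟨ cong (n ∸ k +_) (ℕP.+-identityʳ (n ∸ k)) ⟩
    n ∸ k + (n ∸ k)      ≤⟨ ℕP.+-monoʳ-≤ (n ∸ k) n∸k≤k ⟩
    n ∸ k + k            ≡⟨ ℕP.m∸n+n≡m k≤n ⟩
    n                    ∎
    where
    open ℕP.≤-Reasoning
    n∸k≤k : n ∸ k ≤ k
    n∸k≤k = ℕP.≤-trans (ℕP.∸-monoˡ-≤ k (ℕP.<⇒≤ (ℕP.≰⇒> 2k≰n)))
                       (ℕP.≤-reflexive (trans (cong (λ x → k + x ∸ k) (ℕP.+-identityʳ k)) (ℕP.m+n∸m≡n k k)))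

  numClasses : ∀ n k → k ≤ n → NumClasses n k (classCount n k)
  numClasses n k k≤n with 2 * k ≤? n
  ... | yes 2k≤n = numClasses-triples (∸-2*-+ n k 2k≤n)
  ... | no  2k≰n = NumClasses-mirror k≤n (numClasses-triples (∸-2*-+ n (n ∸ k) (2*-∸-≤ k≤n 2k≰n)))

  length-++-map : ∀ {A B C : Set} (f : A → C) (g : B → C) xs ys → length (map f xs ++ map g ys) ≡ length xs + length ys
  length-++-map f g xs ys = trans (ListP.length-++ (map f xs)) (cong₂ _+_ (ListP.length-map f xs) (ListP.length-map g ys))

  tripleCount-suc-zero : ∀ e → tripleCount (suc e) 0 ≡ tripleCount e 0
  tripleCount-suc-zero e = ListP.length-map (onMid (0 ∷_)) (triples e 0)

  tripleCount-suc-suc : ∀ e d → tripleCount (suc e) (suc d) ≡ tripleCount e (suc d) + tripleCount (suc e) d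
  tripleCount-suc-suc e d = length-++-map (onMid (0 ∷_)) (onMid incHead) (triples e (suc d)) (triples (suc e) d)

  flatCount : ℕ → ℕ
  flatCount = tripleCount 0

  flatCount-closed : ∀ j → flatCount (2 + j) ≡ (j + 5) * 2 ^ j × length (highTriples (2 + j)) ≡ (j + 3) * 2 ^ j
  flatCount-closed zero    = refl , refl
  flatCount-closed (suc j) = flat-suc , high-suc
    where
    compositions-count : ∀ d → length (compositions⁺ d) ≡ 2 ^ d
    compositions-count zero    = refl
    compositions-count (suc d) =
      trans (length-++-map (0 ∷_) incHead (compositions⁺ d) (compositions⁺ d))
            (trans (cong₂ _+_ (compositions-count d) (compositions-count d)) (cong (2 ^ d +_) (sym (ℕP.+-identityʳ (2 ^ d)))))
    ih = flatCount-closed j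
    high-suc : length (highTriples (3 + j)) ≡ (suc j + 3) * 2 ^ suc j
    high-suc = trans (length-++-map (onHigh (0 ∷_)) (onHigh incHead) (flatTriples (2 + j)) (highTriples (2 + j)))
                     (trans (cong₂ _+_ (proj₁ ih) (proj₂ ih)) (double j (2 ^ j)))
      where
      double : ∀ j x → (j + 5) * x + (j + 3) * x ≡ (suc j + 3) * (2 * x)
      double = ℕSolver.solve-∀
    flat-suc : flatCount (3 + j) ≡ (suc j + 5) * 2 ^ suc j
    flat-suc = trans (trans (ListP.length-++ (map flat (compositions (3 + j))))
                            (cong (_+ length (highTriples (3 + j))) (ListP.length-map flat (compositions (3 + j)))))
                     (trans (cong₂ _+_ (compositions-count (2 + j)) high-suc) (double j (2 ^ j)))
      where
      double : ∀ j x → 2 * (2 * x) + (suc j + 3) * (2 * x) ≡ (suc j + 5) * (2 * x)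
      double = ℕSolver.solve-∀

  flatCount-recurrence : ∀ j → flatCount (3 + j) + 4 * flatCount (1 + j) ≡ 4 * flatCount (2 + j)
  flatCount-recurrence zero    = refl
  flatCount-recurrence (suc j) =
    trans (cong₂ (λ x y → x + 4 * y) (proj₁ (flatCount-closed (2 + j))) (proj₁ (flatCount-closed j)))
          (trans (recurrence j (2 ^ j)) (cong (4 *_) (sym (proj₁ (flatCount-closed (suc j))))))
    where
    recurrence : ∀ j x → (2 + j + 5) * (2 * (2 * x)) + 4 * ((j + 5) * x) ≡ 4 * ((suc j + 5) * (2 * x))
    recurrence = ℕSolver.solve-∀

open Counting

module PowerSeries where
  open import Data.Nat as ℕ using (ℕ; zero; suc; _∸_)
  open import Data.Integer using (ℤ; +_; _+_; _-_; _*_)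
  import Data.Integer.Properties as ℤP
  import Data.Integer.Tactic.RingSolver as ℤSolver
  open import Relation.Binary.PropositionalEquality
  import Algebra.Properties.CommutativeSemigroup as CommSemigroupProperties
  private module ℤ+ = CommSemigroupProperties ℤP.+-commutativeSemigroup
  private module ℤ* = CommSemigroupProperties ℤP.*-commutativeSemigroup

  t· x· : Series → Series
  t· f zero    q = + 0
  t· f (suc p) q = f p q
  x· f p zero    = + 0
  x· f p (suc q) = f p q

  _·ᶜ_ : Series → ℤ → Series
  (f ·ᶜ c) p q = f p q * c

  infixl 7 _·ᶜ_

  *-zeroʳ-sumTo : ∀ N (f : ℕ → ℤ) → sumTo N (λ j → f j * + 0) ≡ + 0
  *-zeroʳ-sumTo N f = sumTo-zero N (λ j → ℤP.*-zeroʳ (f j))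

  ⊛-t· : ∀ f g → f ⊛ t· g ≗ˢ t· (f ⊛ g)
  ⊛-t· f g zero    q = *-zeroʳ-sumTo q (f 0)
  ⊛-t· f g (suc p) q = sumTo-∸-suc p (λ a i → sumTo q (λ b → f a b * t· g i (q ∸ b))) (λ a → *-zeroʳ-sumTo q (f a))

  ⊛-x· : ∀ f g → f ⊛ x· g ≗ˢ x· (f ⊛ g)
  ⊛-x· f g p zero    = sumTo-zero p (λ a → ℤP.*-zeroʳ (f a 0))
  ⊛-x· f g p (suc q) = sumTo-cong p (λ a → sumTo-∸-suc q (λ b i → f a b * x· g (p ∸ a) i) (λ b → ℤP.*-zeroʳ (f a b)))

  ⊛-𝟙 : ∀ f → f ⊛ 𝟙 ≗ˢ f
  ⊛-𝟙 f p q =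
    trans (sumTo-∸-last p (λ a i → sumTo q (λ b → f a b * 𝟙 i (q ∸ b))) (λ a i → *-zeroʳ-sumTo q (f a)))
          (trans (sumTo-∸-last q (λ b i → f p b * 𝟙 0 i) (λ b i → ℤP.*-zeroʳ (f p b))) (ℤP.*-identityʳ (f p q)))

  ⊛-·ᶜ : ∀ f g c → f ⊛ (g ·ᶜ c) ≗ˢ (f ⊛ g) ·ᶜ c
  ⊛-·ᶜ f g c p q =
    trans (sumTo-cong p (λ a → trans (sumTo-cong q (λ b → sym (ℤP.*-assoc (f a b) _ c))) (sumTo-*ʳ q c _))) (sumTo-*ʳ p c _)

  ⊛-⊕ : ∀ f g h → f ⊛ (g ⊕ h) ≗ˢ f ⊛ g ⊕ f ⊛ h
  ⊛-⊕ f g h p q =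
    trans (sumTo-cong p (λ a → trans (sumTo-cong q (λ b → ℤP.*-distribˡ-+ (f a b) _ _)) (sumTo-+ q _ _))) (sumTo-+ p _ _)

  ⊛-⊖ : ∀ f g h → f ⊛ (g ⊖ h) ≗ˢ f ⊛ g ⊖ f ⊛ h
  ⊛-⊖ f g h p q =
    trans (sumTo-cong p (λ a → trans (sumTo-cong q (λ b → *-distribˡ-- (f a b) _ _)) (sumTo-- q _ _))) (sumTo-- p _ _)
    where
    *-distribˡ-- : ∀ a b c → a * (b - c) ≡ a * b - a * c
    *-distribˡ-- = ℤSolver.solve-∀

  ⊕-cong : ∀ {f f′ g g′} → f ≗ˢ f′ → g ≗ˢ g′ → f ⊕ g ≗ˢ f′ ⊕ g′
  ⊕-cong f≗f′ g≗g′ p q = cong₂ _+_ (f≗f′ p q) (g≗g′ p q)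

  ⊛-cong : ∀ f {g h} → g ≗ˢ h → f ⊛ g ≗ˢ f ⊛ h
  ⊛-cong f g≗h p q = sumTo-cong p (λ a → sumTo-cong q (λ b → cong (f a b *_) (g≗h (p ∸ a) (q ∸ b))))

  data Poly : Set where
    con       : ℤ → Poly
    𝐭 𝐱       : Poly
    _+ᵖ_ _-ᵖ_ : Poly → Poly → Poly
    _*ᵖ_      : Poly → Poly → Poly

  infixl 6 _+ᵖ_ _-ᵖ_
  infixl 7 _*ᵖ_

  ⟦_⟧ : Poly → Series
  ⟦ con c ⟧  = const c
  ⟦ 𝐭 ⟧      = 𝕥
  ⟦ 𝐱 ⟧      = 𝕩
  ⟦ P +ᵖ Q ⟧ = ⟦ P ⟧ ⊕ ⟦ Q ⟧
  ⟦ P -ᵖ Q ⟧ = ⟦ P ⟧ ⊖ ⟦ Q ⟧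
  ⟦ P *ᵖ Q ⟧ = ⟦ P ⟧ ⊛ ⟦ Q ⟧

  mulBy : Poly → Series → Series
  mulBy (con c)  f = f ·ᶜ c
  mulBy 𝐭        f = t· f
  mulBy 𝐱        f = x· f
  mulBy (P +ᵖ Q) f = mulBy P f ⊕ mulBy Q f
  mulBy (P -ᵖ Q) f = mulBy P f ⊖ mulBy Q f
  mulBy (P *ᵖ Q) f = mulBy Q (mulBy P f)

  record IsPolyLinear (T : Series → Series) : Set where
    field
      ⊕-hom : ∀ f g → T (f ⊕ g) ≗ˢ T f ⊕ T g
      ⊖-hom : ∀ f g → T (f ⊖ g) ≗ˢ T f ⊖ T g
      t·-comm : ∀ f → T (t· f) ≗ˢ t· (T f)
      x·-comm : ∀ f → T (x· f) ≗ˢ x· (T f)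
      ·ᶜ-comm : ∀ f c → T (f ·ᶜ c) ≗ˢ T f ·ᶜ c

  mulBy-cong : ∀ P {f g} → f ≗ˢ g → mulBy P f ≗ˢ mulBy P g
  mulBy-cong (con c)  f≗g p q       = cong (_* c) (f≗g p q)
  mulBy-cong 𝐭        f≗g zero    q = refl
  mulBy-cong 𝐭        f≗g (suc p) q = f≗g p q
  mulBy-cong 𝐱        f≗g p zero    = refl
  mulBy-cong 𝐱        f≗g p (suc q) = f≗g p q
  mulBy-cong (P +ᵖ Q) f≗g p q       = cong₂ _+_ (mulBy-cong P f≗g p q) (mulBy-cong Q f≗g p q)
  mulBy-cong (P -ᵖ Q) f≗g p q       = cong₂ _-_ (mulBy-cong P f≗g p q) (mulBy-cong Q f≗g p q)
  mulBy-cong (P *ᵖ Q) f≗g           = mulBy-cong Q (mulBy-cong P f≗g)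

  mulBy-commutes : ∀ {T} → IsPolyLinear T → ∀ P f → mulBy P (T f) ≗ˢ T (mulBy P f)
  mulBy-commutes T-lin (con c)  f p q = sym (IsPolyLinear.·ᶜ-comm T-lin f c p q)
  mulBy-commutes T-lin 𝐭        f p q = sym (IsPolyLinear.t·-comm T-lin f p q)
  mulBy-commutes T-lin 𝐱        f p q = sym (IsPolyLinear.x·-comm T-lin f p q)
  mulBy-commutes T-lin (P +ᵖ Q) f p q =
    trans (cong₂ _+_ (mulBy-commutes T-lin P f p q) (mulBy-commutes T-lin Q f p q))
          (sym (IsPolyLinear.⊕-hom T-lin (mulBy P f) (mulBy Q f) p q))
  mulBy-commutes T-lin (P -ᵖ Q) f p q =
    trans (cong₂ _-_ (mulBy-commutes T-lin P f p q) (mulBy-commutes T-lin Q f p q))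
          (sym (IsPolyLinear.⊖-hom T-lin (mulBy P f) (mulBy Q f) p q))
  mulBy-commutes T-lin (P *ᵖ Q) f p q =
    trans (mulBy-cong Q (mulBy-commutes T-lin P f) p q) (mulBy-commutes T-lin Q (mulBy P f) p q)

  ⊛-isPolyLinear : ∀ f → IsPolyLinear (f ⊛_)
  ⊛-isPolyLinear f = record
    { ⊕-hom   = ⊛-⊕ f
    ; ⊖-hom   = ⊛-⊖ f
    ; t·-comm = ⊛-t· f
    ; x·-comm = ⊛-x· f
    ; ·ᶜ-comm = ⊛-·ᶜ f
    }

  t·-isPolyLinear : IsPolyLinear t·
  t·-isPolyLinear = record
    { ⊕-hom   = λ { f g zero q → refl ; f g (suc p) q → refl }
    ; ⊖-hom   = λ { f g zero q → refl ; f g (suc p) q → refl }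
    ; t·-comm = λ { f zero q → refl ; f (suc p) q → refl }
    ; x·-comm = λ { f zero zero → refl ; f zero (suc q) → refl ; f (suc p) zero → refl ; f (suc p) (suc q) → refl }
    ; ·ᶜ-comm = λ { f c zero q → refl ; f c (suc p) q → refl }
    }

  x·-isPolyLinear : IsPolyLinear x·
  x·-isPolyLinear = record
    { ⊕-hom   = λ { f g p zero → refl ; f g p (suc q) → refl }
    ; ⊖-hom   = λ { f g p zero → refl ; f g p (suc q) → refl }
    ; t·-comm = λ { f zero zero → refl ; f zero (suc q) → refl ; f (suc p) zero → refl ; f (suc p) (suc q) → refl }
    ; x·-comm = λ { f p zero → refl ; f p (suc q) → refl }
    ; ·ᶜ-comm = λ { f c p zero → refl ; f c p (suc q) → refl }
    }

  ·ᶜ-isPolyLinear : ∀ c → IsPolyLinear (_·ᶜ c)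
  ·ᶜ-isPolyLinear c = record
    { ⊕-hom   = λ f g p q → ℤP.*-distribʳ-+ c (f p q) (g p q)
    ; ⊖-hom   = λ f g p q → *-distribʳ-- (f p q) (g p q) c
    ; t·-comm = λ { f zero q → refl ; f (suc p) q → refl }
    ; x·-comm = λ { f p zero → refl ; f p (suc q) → refl }
    ; ·ᶜ-comm = λ f c′ p q → ℤ*.xy∙z≈xz∙y (f p q) c′ c
    }
    where
    *-distribʳ-- : ∀ a b c → (a - b) * c ≡ a * c - b * c
    *-distribʳ-- = ℤSolver.solve-∀

  mulBy-⊕ : ∀ P f g → mulBy P (f ⊕ g) ≗ˢ mulBy P f ⊕ mulBy P g
  mulBy-⊕ (con c)  = IsPolyLinear.⊕-hom (·ᶜ-isPolyLinear c)
  mulBy-⊕ 𝐭        = IsPolyLinear.⊕-hom t·-isPolyLinear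
  mulBy-⊕ 𝐱        = IsPolyLinear.⊕-hom x·-isPolyLinear
  mulBy-⊕ (P +ᵖ Q) f g p q =
    trans (cong₂ _+_ (mulBy-⊕ P f g p q) (mulBy-⊕ Q f g p q))
          (ℤ+.interchange (mulBy P f p q) (mulBy P g p q) (mulBy Q f p q) (mulBy Q g p q))
  mulBy-⊕ (P -ᵖ Q) f g p q =
    trans (cong₂ _-_ (mulBy-⊕ P f g p q) (mulBy-⊕ Q f g p q))
          (rearrange (mulBy P f p q) (mulBy P g p q) (mulBy Q f p q) (mulBy Q g p q))
    where
    rearrange : ∀ a b c d → (a + b) - (c + d) ≡ (a - c) + (b - d)
    rearrange = ℤSolver.solve-∀
  mulBy-⊕ (P *ᵖ Q) f g p q =
    trans (mulBy-cong Q (mulBy-⊕ P f g) p q) (mulBy-⊕ Q (mulBy P f) (mulBy P g) p q)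

  mulBy-⊖ : ∀ P f g → mulBy P (f ⊖ g) ≗ˢ mulBy P f ⊖ mulBy P g
  mulBy-⊖ (con c)  = IsPolyLinear.⊖-hom (·ᶜ-isPolyLinear c)
  mulBy-⊖ 𝐭        = IsPolyLinear.⊖-hom t·-isPolyLinear
  mulBy-⊖ 𝐱        = IsPolyLinear.⊖-hom x·-isPolyLinear
  mulBy-⊖ (P +ᵖ Q) f g p q =
    trans (cong₂ _+_ (mulBy-⊖ P f g p q) (mulBy-⊖ Q f g p q))
          (rearrange (mulBy P f p q) (mulBy P g p q) (mulBy Q f p q) (mulBy Q g p q))
    where
    rearrange : ∀ a b c d → (a - b) + (c - d) ≡ (a + c) - (b + d)
    rearrange = ℤSolver.solve-∀
  mulBy-⊖ (P -ᵖ Q) f g p q =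
    trans (cong₂ _-_ (mulBy-⊖ P f g p q) (mulBy-⊖ Q f g p q))
          (rearrange (mulBy P f p q) (mulBy P g p q) (mulBy Q f p q) (mulBy Q g p q))
    where
    rearrange : ∀ a b c d → (a - b) - (c - d) ≡ (a - c) - (b - d)
    rearrange = ℤSolver.solve-∀
  mulBy-⊖ (P *ᵖ Q) f g p q =
    trans (mulBy-cong Q (mulBy-⊖ P f g) p q) (mulBy-⊖ Q (mulBy P f) (mulBy P g) p q)

  mulBy-isPolyLinear : ∀ P → IsPolyLinear (mulBy P)
  mulBy-isPolyLinear P = record
    { ⊕-hom   = mulBy-⊕ P
    ; ⊖-hom   = mulBy-⊖ P
    ; t·-comm = mulBy-commutes t·-isPolyLinear P
    ; x·-comm = mulBy-commutes x·-isPolyLinear P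
    ; ·ᶜ-comm = λ f c → mulBy-commutes (·ᶜ-isPolyLinear c) P f
    }

  mulBy-comm : ∀ P Q f → mulBy P (mulBy Q f) ≗ˢ mulBy Q (mulBy P f)
  mulBy-comm P Q = mulBy-commutes (mulBy-isPolyLinear Q) P

  const≗𝟙·ᶜ : ∀ c → const c ≗ˢ 𝟙 ·ᶜ c
  const≗𝟙·ᶜ c zero    zero    = sym (ℤP.*-identityˡ c)
  const≗𝟙·ᶜ c zero    (suc q) = refl
  const≗𝟙·ᶜ c (suc p) q       = refl

  𝕥≗t·𝟙 : 𝕥 ≗ˢ t· 𝟙
  𝕥≗t·𝟙 zero          q       = refl
  𝕥≗t·𝟙 (suc zero)    zero    = refl
  𝕥≗t·𝟙 (suc zero)    (suc q) = refl
  𝕥≗t·𝟙 (suc (suc p)) q       = refl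

  𝕩≗x·𝟙 : 𝕩 ≗ˢ x· 𝟙
  𝕩≗x·𝟙 zero    zero          = refl
  𝕩≗x·𝟙 zero    (suc zero)    = refl
  𝕩≗x·𝟙 zero    (suc (suc q)) = refl
  𝕩≗x·𝟙 (suc p) zero          = refl
  𝕩≗x·𝟙 (suc p) (suc q)       = refl

  ⊛-⟦⟧ : ∀ f P → f ⊛ ⟦ P ⟧ ≗ˢ mulBy P f
  ⊛-⟦⟧ f (con c) p q = trans (⊛-cong f (const≗𝟙·ᶜ c) p q) (trans (⊛-·ᶜ f 𝟙 c p q) (cong (_* c) (⊛-𝟙 f p q)))
  ⊛-⟦⟧ f 𝐭 p q = trans (⊛-cong f 𝕥≗t·𝟙 p q) (trans (⊛-t· f 𝟙 p q) (mulBy-cong 𝐭 (⊛-𝟙 f) p q))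
  ⊛-⟦⟧ f 𝐱 p q = trans (⊛-cong f 𝕩≗x·𝟙 p q) (trans (⊛-x· f 𝟙 p q) (mulBy-cong 𝐱 (⊛-𝟙 f) p q))
  ⊛-⟦⟧ f (P +ᵖ Q) p q = trans (⊛-⊕ f ⟦ P ⟧ ⟦ Q ⟧ p q) (cong₂ _+_ (⊛-⟦⟧ f P p q) (⊛-⟦⟧ f Q p q))
  ⊛-⟦⟧ f (P -ᵖ Q) p q = trans (⊛-⊖ f ⟦ P ⟧ ⟦ Q ⟧ p q) (cong₂ _-_ (⊛-⟦⟧ f P p q) (⊛-⟦⟧ f Q p q))
  ⊛-⟦⟧ f (P *ᵖ Q) p q = begin
    (f ⊛ (⟦ P ⟧ ⊛ ⟦ Q ⟧)) p q   ≡⟨ ⊛-cong f (⊛-⟦⟧ ⟦ P ⟧ Q) p q ⟩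
    (f ⊛ mulBy Q ⟦ P ⟧) p q     ≡⟨ sym (mulBy-commutes (⊛-isPolyLinear f) Q ⟦ P ⟧ p q) ⟩
    mulBy Q (f ⊛ ⟦ P ⟧) p q     ≡⟨ mulBy-cong Q (⊛-⟦⟧ f P) p q ⟩
    mulBy Q (mulBy P f) p q     ∎
    where open ≡-Reasoning

  ⟦⟧≗mulBy-𝟙 : ∀ P → ⟦ P ⟧ ≗ˢ mulBy P 𝟙
  ⟦⟧≗mulBy-𝟙 (con c)  = const≗𝟙·ᶜ c
  ⟦⟧≗mulBy-𝟙 𝐭        = 𝕥≗t·𝟙
  ⟦⟧≗mulBy-𝟙 𝐱        = 𝕩≗x·𝟙
  ⟦⟧≗mulBy-𝟙 (P +ᵖ Q) p q = cong₂ _+_ (⟦⟧≗mulBy-𝟙 P p q) (⟦⟧≗mulBy-𝟙 Q p q)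
  ⟦⟧≗mulBy-𝟙 (P -ᵖ Q) p q = cong₂ _-_ (⟦⟧≗mulBy-𝟙 P p q) (⟦⟧≗mulBy-𝟙 Q p q)
  ⟦⟧≗mulBy-𝟙 (P *ᵖ Q) p q = trans (⊛-⟦⟧ ⟦ P ⟧ Q p q) (mulBy-cong Q (⟦⟧≗mulBy-𝟙 P) p q)

open PowerSeries

module Recurrences where
  open import Data.Nat as ℕ using (ℕ; zero; suc; z≤n; s≤s; _+_; _*_; _∸_; _≤_; _<_; _≤?_)
  import Data.Nat.Properties as ℕP
  import Data.Nat.Tactic.RingSolver as ℕSolver
  import Data.Integer as ℤ
  import Data.Integer.Properties as ℤP
  import Data.Integer.Tactic.RingSolver as ℤSolver
  open import Data.Product using (∃; ∃₂; _×_; _,_)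
  open import Data.Sum using (_⊎_; inj₁; inj₂)
  open import Function using (_∘_)
  open import Relation.Binary.PropositionalEquality
  open import Relation.Nullary using (¬_; yes; no; contradiction)
  open import Relation.Nullary.Decidable using (toSum)

  -- Unlike 2 * k, double (suc k) reduces to suc (suc (double k)), which matches the
  -- shift by tx².
  double : ℕ → ℕ
  double zero    = 0
  double (suc k) = suc (suc (double k))

  double≡2* : ∀ k → double k ≡ 2 * k
  double≡2* zero    = refl
  double≡2* (suc k) = trans (cong (suc ∘ suc) (double≡2* k)) (sym (2*-suc k))
    where
    2*-suc : ∀ k → 2 * suc k ≡ suc (suc (2 * k))
    2*-suc = ℕSolver.solve-∀

  double-view : ∀ k n → (∃ λ e → n ≡ double k + e) ⊎ n < double k
  double-view k n with double k ≤? n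
  ... | yes le = inj₁ (n ∸ double k , sym (ℕP.m+[n∸m]≡n le))
  ... | no  gt = inj₂ (ℕP.≰⇒> gt)

  lower : Series
  lower = genA½ classCount

  upper : Series
  upper k n with k ≤? n | 2 * k ≤? n
  ... | yes _ | no _  = ℤ.+ classCount n k
  ... | _     | _     = ℤ.+ 0

  diagonal : Series
  diagonal k n with n ℕ.≟ double k
  ... | yes _ = ℤ.+ flatCount k
  ... | no  _ = ℤ.+ 0

  genA-split : ∀ k n → genA classCount k n ≡ lower k n ℤ.+ upper k n
  genA-split k n with k ≤? n | 2 * k ≤? n
  ... | yes _   | yes _    = sym (ℤP.+-identityʳ _)
  ... | yes _   | no  _    = sym (ℤP.+-identityˡ _)
  ... | no  _   | no  _    = refl
  ... | no  k≰n | yes 2k≤n = contradiction (ℕP.≤-trans (ℕP.m≤m+n k (k + 0)) 2k≤n) k≰n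

  lower-value : ∀ k e → lower k (double k + e) ≡ ℤ.+ tripleCount e k
  lower-value k e with 2 * k ≤? double k + e
  ... | no  2k≰n = contradiction (subst (_≤ double k + e) (double≡2* k) (ℕP.m≤m+n (double k) e)) 2k≰n
  ... | yes 2k≤n with 2 * k ≤? double k + e
  ...   | no  2k≰n = contradiction 2k≤n 2k≰n
  ...   | yes _    = cong (λ e′ → ℤ.+ tripleCount e′ k)
                          (trans (cong (λ d → d + e ∸ 2 * k) (double≡2* k)) (ℕP.m+n∸m≡n (2 * k) e))

  lower-below : ∀ k n → n < double k → lower k n ≡ ℤ.+ 0
  lower-below k n n<2k with 2 * k ≤? n
  ... | yes 2k≤n = contradiction (subst (_≤ n) (sym (double≡2* k)) 2k≤n) (ℕP.<⇒≱ n<2k)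
  ... | no  _    = refl

  diagonal-on : ∀ k → diagonal k (double k) ≡ ℤ.+ flatCount k
  diagonal-on k with double k ℕ.≟ double k
  ... | yes _ = refl
  ... | no ne = contradiction refl ne

  diagonal-on′ : ∀ k → diagonal k (double k + 0) ≡ ℤ.+ flatCount k
  diagonal-on′ k = trans (cong (diagonal k) (ℕP.+-identityʳ (double k))) (diagonal-on k)

  diagonal-off : ∀ k n → n ≢ double k → diagonal k n ≡ ℤ.+ 0
  diagonal-off k n ne with n ℕ.≟ double k
  ... | yes eq = contradiction eq ne
  ... | no  _  = refl

  𝟏 tx²ᵖ 1-x-tx² 1-tx-tx² 1-2tx² 1-tx² : Poly
  𝟏        = con (ℤ.+ 1)
  tx²ᵖ     = 𝐭 *ᵖ (𝐱 *ᵖ 𝐱)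
  1-x-tx²  = 𝟏 -ᵖ 𝐱 -ᵖ tx²ᵖ
  1-tx-tx² = 𝟏 -ᵖ 𝐭 *ᵖ 𝐱 -ᵖ tx²ᵖ
  1-2tx²   = 𝟏 -ᵖ con (ℤ.+ 2) *ᵖ tx²ᵖ
  1-tx²    = 𝟏 -ᵖ tx²ᵖ

  numeratorᵖ : Poly
  numeratorᵖ = 𝟏 -ᵖ con (ℤ.+ 3) *ᵖ tx²ᵖ +ᵖ tx²ᵖ *ᵖ tx²ᵖ

  tx²· : Series → Series
  tx²· f = t· (x· (x· f))

  mulBy-tx² : ∀ f → mulBy tx²ᵖ f ≗ˢ tx²· f
  mulBy-tx² = mulBy-commutes t·-isPolyLinear (𝐱 *ᵖ 𝐱)

  mulBy-1- : ∀ P f k n → mulBy (𝟏 -ᵖ P) f k n ≡ f k n ℤ.- mulBy P f k n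
  mulBy-1- P f k n = cong (ℤ._- mulBy P f k n) (ℤP.*-identityʳ (f k n))

  mulBy-1-x-tx² : ∀ f k n → mulBy 1-x-tx² f k n ≡ f k n ℤ.- x· f k n ℤ.- tx²· f k n
  mulBy-1-x-tx² f k n = cong₂ ℤ._-_ (mulBy-1- 𝐱 f k n) (mulBy-tx² f k n)

  mulBy-1-tx-tx² : ∀ f k n → mulBy 1-tx-tx² f k n ≡ f k n ℤ.- t· (x· f) k n ℤ.- tx²· f k n
  mulBy-1-tx-tx² f k n =
    cong₂ ℤ._-_ (trans (mulBy-1- (𝐭 *ᵖ 𝐱) f k n) (cong (ℤ._-_ (f k n)) (mulBy-commutes t·-isPolyLinear 𝐱 f k n)))
                (mulBy-tx² f k n)

  mulBy-1-tx² : ∀ f k n → mulBy 1-tx² f k n ≡ f k n ℤ.- tx²· f k n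
  mulBy-1-tx² f k n = trans (mulBy-1- tx²ᵖ f k n) (cong (ℤ._-_ (f k n)) (mulBy-tx² f k n))

  mulBy-[1-P]² : ∀ P f k n →
                 mulBy ((𝟏 -ᵖ P) *ᵖ (𝟏 -ᵖ P)) f k n ≡ f k n ℤ.- ℤ.+ 2 ℤ.* mulBy P f k n ℤ.+ mulBy P (mulBy P f) k n
  mulBy-[1-P]² P f k n = begin
    (g k n ℤ.* ℤ.+ 1) ℤ.- mulBy P g k n
      ≡⟨ cong (ℤ._-_ (g k n ℤ.* ℤ.+ 1)) (trans (⊖-hom (f ·ᶜ ℤ.+ 1) (mulBy P f) k n)
                                            (cong (ℤ._- mulBy P (mulBy P f) k n) (·ᶜ-comm f (ℤ.+ 1) k n))) ⟩
    (g k n ℤ.* ℤ.+ 1) ℤ.- (mulBy P f k n ℤ.* ℤ.+ 1 ℤ.- mulBy P (mulBy P f) k n)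
      ≡⟨ expand (f k n) (mulBy P f k n) (mulBy P (mulBy P f) k n) ⟩
    f k n ℤ.- ℤ.+ 2 ℤ.* mulBy P f k n ℤ.+ mulBy P (mulBy P f) k n ∎
    where
    open ≡-Reasoning
    open IsPolyLinear (mulBy-isPolyLinear P)
    g = mulBy (𝟏 -ᵖ P) f
    expand : ∀ a b c → (a ℤ.* ℤ.+ 1 ℤ.- b) ℤ.* ℤ.+ 1 ℤ.- (b ℤ.* ℤ.+ 1 ℤ.- c) ≡ a ℤ.- ℤ.+ 2 ℤ.* b ℤ.+ c
    expand = ℤSolver.solve-∀

  ℤ-recurrence : ∀ a b c → a ≡ b + c → ℤ.+ a ℤ.- ℤ.+ b ℤ.- ℤ.+ c ≡ ℤ.+ 0
  ℤ-recurrence a b c refl = trans (cong (λ z → z ℤ.- ℤ.+ b ℤ.- ℤ.+ c) (ℤP.pos-+ b c)) (cancel (ℤ.+ b) (ℤ.+ c))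
    where
    cancel : ∀ x y → x ℤ.+ y ℤ.- x ℤ.- y ≡ ℤ.+ 0
    cancel = ℤSolver.solve-∀

  ℤ-recurrence₄ : ∀ a b c → a + 4 * c ≡ 4 * b → ℤ.+ a ℤ.- ℤ.+ 4 ℤ.* ℤ.+ b ℤ.+ ℤ.+ 4 ℤ.* ℤ.+ c ≡ ℤ.+ 0
  ℤ-recurrence₄ a b c eq = begin
    ℤ.+ a ℤ.- ℤ.+ 4 ℤ.* ℤ.+ b ℤ.+ ℤ.+ 4 ℤ.* ℤ.+ c ≡⟨ rearrange (ℤ.+ a) (ℤ.+ b) (ℤ.+ c) ⟩
    (ℤ.+ a ℤ.+ ℤ.+ 4 ℤ.* ℤ.+ c) ℤ.- ℤ.+ 4 ℤ.* ℤ.+ b ≡⟨ cong₂ ℤ._-_ lhs (sym (ℤP.pos-* 4 b)) ⟩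
    ℤ.+ (4 * b) ℤ.- ℤ.+ (4 * b)                     ≡⟨ ℤP.+-inverseʳ (ℤ.+ (4 * b)) ⟩
    ℤ.+ 0                                            ∎
    where
    open ≡-Reasoning
    rearrange : ∀ a b c → a ℤ.- ℤ.+ 4 ℤ.* b ℤ.+ ℤ.+ 4 ℤ.* c ≡ (a ℤ.+ ℤ.+ 4 ℤ.* c) ℤ.- ℤ.+ 4 ℤ.* b
    rearrange = ℤSolver.solve-∀
    lhs : ℤ.+ a ℤ.+ ℤ.+ 4 ℤ.* ℤ.+ c ≡ ℤ.+ (4 * b)
    lhs = trans (cong (ℤ._+_ (ℤ.+ a)) (sym (ℤP.pos-* 4 c))) (trans (sym (ℤP.pos-+ a (4 * c))) (cong ℤ.+_ eq))

  double+suc≢ : ∀ k e → double k + suc e ≢ double k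
  double+suc≢ k e = ℕP.m+1+n≢m (double k)

  lower-on : ∀ k e → lower (suc k) (2 + double k + e) ℤ.- lower (suc k) (1 + double k + e) ℤ.- lower k (double k + e)
                     ≡ diagonal (suc k) (2 + double k + e) ℤ.- diagonal k (double k + e)
  lower-on k zero    = begin
    lower (suc k) (2 + double k + 0) ℤ.- lower (suc k) (1 + double k + 0) ℤ.- lower k (double k + 0)
      ≡⟨ cong₂ ℤ._-_ (cong₂ ℤ._-_ (lower-value (suc k) 0)
                                  (lower-below (suc k) (1 + double k + 0) (s≤s (s≤s (ℕP.≤-reflexive (ℕP.+-identityʳ _))))))
                     (lower-value k 0) ⟩
    ℤ.+ flatCount (suc k) ℤ.- ℤ.+ 0 ℤ.- ℤ.+ flatCount k
      ≡⟨ cong (ℤ._- ℤ.+ flatCount k) (ℤP.+-identityʳ (ℤ.+ flatCount (suc k))) ⟩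
    ℤ.+ flatCount (suc k) ℤ.- ℤ.+ flatCount k
      ≡⟨ sym (cong₂ ℤ._-_ (diagonal-on′ (suc k)) (diagonal-on′ k)) ⟩
    diagonal (suc k) (2 + double k + 0) ℤ.- diagonal k (double k + 0) ∎
    where open ≡-Reasoning
  lower-on k (suc e) = begin
    lower (suc k) (2 + double k + suc e) ℤ.- lower (suc k) (1 + double k + suc e) ℤ.- lower k (double k + suc e)
      ≡⟨ cong₂ ℤ._-_ (cong₂ ℤ._-_ (lower-value (suc k) (suc e))
                                  (trans (cong (lower (suc k) ∘ suc) (ℕP.+-suc (double k) e)) (lower-value (suc k) e)))
                     (lower-value k (suc e)) ⟩
    ℤ.+ tripleCount (suc e) (suc k) ℤ.- ℤ.+ tripleCount e (suc k) ℤ.- ℤ.+ tripleCount (suc e) k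
      ≡⟨ ℤ-recurrence _ (tripleCount e (suc k)) (tripleCount (suc e) k) (tripleCount-suc-suc e k) ⟩
    ℤ.+ 0
      ≡⟨ sym (cong₂ ℤ._-_ (diagonal-off (suc k) (2 + double k + suc e)
                                        (double+suc≢ k e ∘ ℕP.suc-injective ∘ ℕP.suc-injective))
                          (diagonal-off k (double k + suc e) (double+suc≢ k e))) ⟩
    diagonal (suc k) (2 + double k + suc e) ℤ.- diagonal k (double k + suc e) ∎
    where open ≡-Reasoning

  lower-core : ∀ k n → lower k n ℤ.- x· lower k n ℤ.- tx²· lower k n ≡ diagonal k n ℤ.- tx²· diagonal k n
  lower-core zero    zero          = refl
  lower-core zero    (suc n)       =
    trans (cong₂ (λ a b → a ℤ.- b ℤ.- ℤ.+ 0) (lower-value 0 (suc n)) (lower-value 0 n))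
          (ℤ-recurrence _ (tripleCount n 0) 0 (trans (tripleCount-suc-zero n) (sym (ℕP.+-identityʳ _))))
  lower-core (suc k) zero          = cong (λ a → a ℤ.- ℤ.+ 0 ℤ.- ℤ.+ 0) (lower-below (suc k) 0 (s≤s z≤n))
  lower-core (suc k) (suc zero)    =
    cong₂ (λ a b → a ℤ.- b ℤ.- ℤ.+ 0) (lower-below (suc k) 1 (s≤s (s≤s z≤n))) (lower-below (suc k) 0 (s≤s z≤n))
  lower-core (suc k) (suc (suc n)) with double-view k n
  ... | inj₂ n<2k = begin
    lower (suc k) (2 + n) ℤ.- lower (suc k) (1 + n) ℤ.- lower k n
      ≡⟨ cong₂ ℤ._-_ (cong₂ ℤ._-_ (lower-below (suc k) (2 + n) (s≤s (s≤s n<2k)))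
                                  (lower-below (suc k) (1 + n) (s≤s (ℕP.m≤n⇒m≤1+n n<2k))))
                     (lower-below k n n<2k) ⟩
    ℤ.+ 0
      ≡⟨ cong₂ ℤ._-_ (sym (diagonal-off (suc k) (2 + n) (ℕP.<⇒≢ n<2k ∘ ℕP.suc-injective ∘ ℕP.suc-injective)))
                     (sym (diagonal-off k n (ℕP.<⇒≢ n<2k))) ⟩
    diagonal (suc k) (2 + n) ℤ.- diagonal k n ∎
    where open ≡-Reasoning
  ... | inj₁ (e , refl) = lower-on k e

  lower-recurrence : mulBy 1-x-tx² lower ≗ˢ mulBy 1-tx² diagonal
  lower-recurrence k n = trans (mulBy-1-x-tx² lower k n) (trans (lower-core k n) (sym (mulBy-1-tx² diagonal k n)))

  double≡+ : ∀ d → double d ≡ d + d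
  double≡+ d = trans (double≡2* d) (cong (d +_) (ℕP.+-identityʳ d))

  classCount-high : ∀ n k → ¬ (2 * k ≤ n) → classCount n k ≡ tripleCount (n ∸ 2 * (n ∸ k)) (n ∸ k)
  classCount-high n k 2k≰n with 2 * k ≤? n
  ... | yes 2k≤n = contradiction 2k≤n 2k≰n
  ... | no  _    = refl

  upper-value : ∀ g d → upper (suc g + d) (suc g + double d) ≡ ℤ.+ tripleCount (suc g) d
  upper-value g d with suc g + d ≤? suc g + double d | 2 * (suc g + d) ≤? suc g + double d
  ... | no k≰n  | _         = contradiction (ℕP.+-monoʳ-≤ (suc g) (subst (d ≤_) (sym (double≡+ d)) (ℕP.m≤m+n d d))) k≰n
  ... | yes _   | yes 2k≤n  =
    contradiction 2k≤n (ℕP.<⇒≱ (ℕP.≤-<-trans (ℕP.≤-reflexive (cong (suc g +_) (double≡+ d))) lt))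
    where
    lt : suc g + (d + d) < 2 * (suc g + d)
    lt = subst (suc g + (d + d) <_) (sym (expand g d)) (ℕP.+-monoʳ-< (suc g) (ℕP.m<n+m (d + d) {suc g} (s≤s z≤n)))
      where
      expand : ∀ g d → 2 * (suc g + d) ≡ suc g + (suc g + (d + d))
      expand = ℕSolver.solve-∀
  ... | yes _   | no  2k≰n  =
    cong ℤ.+_ (trans (classCount-high (suc g + double d) (suc g + d) 2k≰n) (cong₂ tripleCount e≡ d≡))
    where
    d≡ : suc g + double d ∸ (suc g + d) ≡ d
    d≡ = trans (ℕP.[m+n]∸[m+o]≡n∸o (suc g) (double d) d) (trans (cong (_∸ d) (double≡+ d)) (ℕP.m+n∸m≡n d d))
    e≡ : suc g + double d ∸ 2 * (suc g + double d ∸ (suc g + d)) ≡ suc g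
    e≡ = trans (cong (λ x → suc g + double d ∸ 2 * x) d≡)
               (trans (cong (λ x → suc g + x ∸ 2 * d) (double≡2* d)) (ℕP.m+n∸n≡m (suc g) (2 * d)))

  upper-zero : ∀ k n → 2 * k ≤ n ⊎ n < k → upper k n ≡ ℤ.+ 0
  upper-zero k n out with k ≤? n | 2 * k ≤? n
  ... | yes _   | yes _    = refl
  ... | no  _   | _        = refl
  ... | yes k≤n | no  2k≰n with out
  ...   | inj₁ 2k≤n = contradiction 2k≤n 2k≰n
  ...   | inj₂ n<k  = contradiction k≤n (ℕP.<⇒≱ n<k)

  upper-view : ∀ k n → n < k ⊎ double k ≤ n ⊎ ∃₂ λ g d → k ≡ suc g + d × n ≡ suc g + double d
  upper-view k n with n ℕ.<? k | double k ≤? n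
  ... | yes n<k | _       = inj₁ n<k
  ... | no  _   | yes 2k≤n = inj₂ (inj₁ 2k≤n)
  ... | no  n≮k | no  2k≰n = inj₂ (inj₂ (k ∸ suc d , d , k≡ , n≡))
    where
    d = n ∸ k
    n≡k+d : n ≡ k + d
    n≡k+d = sym (ℕP.m+[n∸m]≡n (ℕP.≮⇒≥ n≮k))
    d<k : d < k
    d<k = ℕP.+-cancelˡ-< k d k (subst₂ _<_ n≡k+d (double≡+ k) (ℕP.≰⇒> 2k≰n))
    k≡ : k ≡ suc (k ∸ suc d) + d
    k≡ = trans (sym (ℕP.m∸n+n≡m d<k)) (ℕP.+-suc (k ∸ suc d) d)
    n≡ : n ≡ suc (k ∸ suc d) + double d
    n≡ = trans n≡k+d (trans (cong (_+ d) k≡)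
                            (trans (ℕP.+-assoc (suc (k ∸ suc d)) d d) (cong (suc (k ∸ suc d) +_) (sym (double≡+ d)))))

  double-+ : ∀ a b → double (a + b) ≡ double a + double b
  double-+ zero    b = refl
  double-+ (suc a) b = cong (suc ∘ suc) (double-+ a b)

  ≤double : ∀ n → n ≤ double n
  ≤double zero    = z≤n
  ≤double (suc n) = s≤s (ℕP.m≤n⇒m≤1+n (≤double n))

  ≢1+double : ∀ n → n ≢ suc (double n)
  ≢1+double n = ℕP.<⇒≢ (s≤s (≤double n))

  ℤ-subtract : ∀ a b c → a ≡ b + c → ℤ.+ a ℤ.- ℤ.+ c ≡ ℤ.+ b
  ℤ-subtract a b c refl = trans (cong (ℤ._- ℤ.+ c) (ℤP.pos-+ b c)) (cancel (ℤ.+ b) (ℤ.+ c))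
    where
    cancel : ∀ x y → x ℤ.+ y ℤ.- y ≡ x
    cancel = ℤSolver.solve-∀

  upper-band : ∀ g d {n} → suc n ≡ g + double d →
               upper (suc g + d) (2 + n) ℤ.- upper (g + d) (suc n) ℤ.- upper (g + d) n ≡ diagonal (g + d) (suc n)
  upper-band zero    zero    ()
  upper-band zero    (suc d) refl = begin
    upper (2 + d) (3 + double d) ℤ.- upper (suc d) (2 + double d) ℤ.- upper (suc d) (suc (double d))
      ≡⟨ cong₂ ℤ._-_ (cong₂ ℤ._-_ (upper-value 0 (suc d))
                                  (upper-zero (suc d) (2 + double d)
                                              (inj₁ (subst (_≤ 2 + double d) (double≡2* (suc d)) ℕP.≤-refl))))
                     (upper-value 0 d) ⟩
    ℤ.+ tripleCount 1 (suc d) ℤ.- ℤ.+ 0 ℤ.- ℤ.+ tripleCount 1 d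
      ≡⟨ trans (cong (ℤ._- ℤ.+ tripleCount 1 d) (ℤP.+-identityʳ (ℤ.+ tripleCount 1 (suc d))))
               (ℤ-subtract _ _ _ (tripleCount-suc-suc 0 d)) ⟩
    ℤ.+ flatCount (suc d)
      ≡⟨ sym (diagonal-on (suc d)) ⟩
    diagonal (suc d) (2 + double d) ∎
    where open ≡-Reasoning
  upper-band (suc g) zero    refl = begin
    upper (2 + g + 0) (2 + g + 0) ℤ.- upper (1 + g + 0) (1 + g + 0) ℤ.- upper (1 + g + 0) (g + 0)
      ≡⟨ cong₂ ℤ._-_ (cong₂ ℤ._-_ (upper-value (suc g) 0) (upper-value g 0))
                     (upper-zero (1 + g + 0) (g + 0) (inj₂ ℕP.≤-refl)) ⟩
    ℤ.+ tripleCount (2 + g) 0 ℤ.- ℤ.+ tripleCount (1 + g) 0 ℤ.- ℤ.+ 0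
      ≡⟨ ℤ-recurrence _ (tripleCount (1 + g) 0) 0 (trans (tripleCount-suc-zero (suc g)) (sym (ℕP.+-identityʳ _))) ⟩
    ℤ.+ 0
      ≡⟨ sym (diagonal-off (1 + g + 0) (1 + g + 0) (≢1+double (g + 0) ∘ ℕP.suc-injective)) ⟩
    diagonal (1 + g + 0) (1 + g + 0) ∎
    where open ≡-Reasoning
  upper-band (suc g) (suc d) refl = begin
    upper (2 + g + suc d) (2 + g + double (suc d)) ℤ.- upper (1 + g + suc d) (1 + g + double (suc d))
      ℤ.- upper (1 + g + suc d) (g + double (suc d))
      ≡⟨ cong₂ ℤ._-_ (cong₂ ℤ._-_ (upper-value (suc g) (suc d)) (upper-value g (suc d)))
                     (trans (cong₂ upper (cong suc (ℕP.+-suc g d))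
                                         (trans (ℕP.+-suc g (suc (double d))) (cong suc (ℕP.+-suc g (double d)))))
                            (upper-value (suc g) d)) ⟩
    ℤ.+ tripleCount (2 + g) (suc d) ℤ.- ℤ.+ tripleCount (1 + g) (suc d) ℤ.- ℤ.+ tripleCount (2 + g) d
      ≡⟨ ℤ-recurrence _ (tripleCount (1 + g) (suc d)) (tripleCount (2 + g) d) (tripleCount-suc-suc (suc g) d) ⟩
    ℤ.+ 0
      ≡⟨ sym (diagonal-off (1 + g + suc d) (1 + g + double (suc d)) off) ⟩
    diagonal (1 + g + suc d) (1 + g + double (suc d)) ∎
    where
    open ≡-Reasoning
    off : 1 + g + double (suc d) ≢ double (1 + g + suc d)
    off eq = ≢1+double g (ℕP.+-cancelʳ-≡ (double (suc d)) g (suc (double g))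
               (trans (ℕP.suc-injective eq) (cong suc (double-+ g (suc d)))))

  upper-core : ∀ k n → upper k n ℤ.- t· (x· upper) k n ℤ.- tx²· upper k n ≡ t· (x· diagonal) k n
  upper-core zero                n             = cong (λ a → a ℤ.- ℤ.+ 0 ℤ.- ℤ.+ 0) (upper-zero 0 n (inj₁ z≤n))
  upper-core (suc k)             zero          = cong (λ a → a ℤ.- ℤ.+ 0 ℤ.- ℤ.+ 0) (upper-zero (suc k) 0 (inj₂ (s≤s z≤n)))
  upper-core (suc zero)          (suc zero)    = refl
  upper-core (suc (suc k))       (suc zero)    =
    cong₂ (λ a b → a ℤ.- b ℤ.- ℤ.+ 0) (upper-zero (2 + k) 1 (inj₂ (s≤s (s≤s z≤n))))
                                      (upper-zero (suc k) 0 (inj₂ (s≤s z≤n)))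
  upper-core (suc k)             (suc (suc n)) with upper-view (suc k) (2 + n)
  ... | inj₁ (s≤s n+2≤k) = begin
    upper (suc k) (2 + n) ℤ.- upper k (suc n) ℤ.- upper k n
      ≡⟨ cong₂ ℤ._-_ (cong₂ ℤ._-_ (upper-zero (suc k) (2 + n) (inj₂ (s≤s n+2≤k)))
                                  (upper-zero k (suc n) (inj₂ n+2≤k)))
                     (upper-zero k n (inj₂ (ℕP.<-trans (ℕP.n<1+n n) n+2≤k))) ⟩
    ℤ.+ 0
      ≡⟨ sym (diagonal-off k (suc n) (ℕP.<⇒≢ (ℕP.<-≤-trans n+2≤k (≤double k)))) ⟩
    diagonal k (suc n) ∎
    where open ≡-Reasoning
  ... | inj₂ (inj₁ (s≤s (s≤s 2k≤n))) = begin
    upper (suc k) (2 + n) ℤ.- upper k (suc n) ℤ.- upper k n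
      ≡⟨ cong₂ ℤ._-_ (cong₂ ℤ._-_ (upper-zero (suc k) (2 + n)
                                              (inj₁ (subst (_≤ 2 + n) (double≡2* (suc k)) (s≤s (s≤s 2k≤n)))))
                                  (upper-zero k (suc n) (inj₁ (ℕP.m≤n⇒m≤1+n (subst (_≤ n) (double≡2* k) 2k≤n)))))
                     (upper-zero k n (inj₁ (subst (_≤ n) (double≡2* k) 2k≤n))) ⟩
    ℤ.+ 0
      ≡⟨ sym (diagonal-off k (suc n) (ℕP.<⇒≢ (s≤s 2k≤n) ∘ sym)) ⟩
    diagonal k (suc n) ∎
    where open ≡-Reasoning
  ... | inj₂ (inj₂ (g , d , refl , n≡)) = upper-band g d (ℕP.suc-injective n≡)

  upper-recurrence : mulBy 1-tx-tx² upper ≗ˢ mulBy (𝐭 *ᵖ 𝐱) diagonal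
  upper-recurrence k n =
    trans (mulBy-1-tx-tx² upper k n) (trans (upper-core k n) (sym (mulBy-commutes t·-isPolyLinear 𝐱 diagonal k n)))

  tx²·-·ᶜ : ∀ f c → tx²· (f ·ᶜ c) ≗ˢ tx²· f ·ᶜ c
  tx²·-·ᶜ = IsPolyLinear.·ᶜ-comm (mulBy-isPolyLinear (𝐱 *ᵖ 𝐱 *ᵖ 𝐭))

  mulBy-tx²-tx² : ∀ f → mulBy tx²ᵖ (mulBy tx²ᵖ f) ≗ˢ tx²· (tx²· f)
  mulBy-tx²-tx² f k n = trans (mulBy-tx² (mulBy tx²ᵖ f) k n) (mulBy-cong (𝐱 *ᵖ 𝐱 *ᵖ 𝐭) (mulBy-tx² f) k n)

  mulBy-2tx² : ∀ f → mulBy (con (ℤ.+ 2) *ᵖ tx²ᵖ) f ≗ˢ tx²· f ·ᶜ ℤ.+ 2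
  mulBy-2tx² f k n = trans (mulBy-tx² (f ·ᶜ ℤ.+ 2) k n) (tx²·-·ᶜ f (ℤ.+ 2) k n)

  mulBy-[1-2tx²]² : ∀ f k n →
                    mulBy (1-2tx² *ᵖ 1-2tx²) f k n ≡ f k n ℤ.- ℤ.+ 4 ℤ.* tx²· f k n ℤ.+ ℤ.+ 4 ℤ.* tx²· (tx²· f) k n
  mulBy-[1-2tx²]² f k n =
    trans (mulBy-[1-P]² 2tx² f k n)
          (trans (cong₂ (λ b c → f k n ℤ.- ℤ.+ 2 ℤ.* b ℤ.+ c) (mulBy-2tx² f k n)
                        (trans (mulBy-2tx² (mulBy 2tx² f) k n)
                               (cong (ℤ._* ℤ.+ 2) (trans (mulBy-cong (𝐱 *ᵖ 𝐱 *ᵖ 𝐭) (mulBy-2tx² f) k n)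
                                                         (tx²·-·ᶜ (tx²· f) (ℤ.+ 2) k n)))))
                 (collect (f k n) (tx²· f k n) (tx²· (tx²· f) k n)))
    where
    2tx² = con (ℤ.+ 2) *ᵖ tx²ᵖ
    collect : ∀ a b c → a ℤ.- ℤ.+ 2 ℤ.* (b ℤ.* ℤ.+ 2) ℤ.+ c ℤ.* ℤ.+ 2 ℤ.* ℤ.+ 2
                      ≡ a ℤ.- ℤ.+ 4 ℤ.* b ℤ.+ ℤ.+ 4 ℤ.* c
    collect = ℤSolver.solve-∀

  mulBy-[1-tx²]² : ∀ f k n →
                   mulBy (1-tx² *ᵖ 1-tx²) f k n ≡ f k n ℤ.- ℤ.+ 2 ℤ.* tx²· f k n ℤ.+ tx²· (tx²· f) k n
  mulBy-[1-tx²]² f k n =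
    trans (mulBy-[1-P]² tx²ᵖ f k n)
          (cong₂ (λ b c → f k n ℤ.- ℤ.+ 2 ℤ.* b ℤ.+ c) (mulBy-tx² f k n) (mulBy-tx²-tx² f k n))

  diagonal-shifted : ∀ k n → diagonal (2 + k) (4 + n) ℤ.- ℤ.+ 4 ℤ.* diagonal (1 + k) (2 + n) ℤ.+ ℤ.+ 4 ℤ.* diagonal k n
                             ≡ 𝟙 k n
  diagonal-shifted k n with toSum (n ℕ.≟ double k)
  ... | inj₁ refl = begin
    diagonal (2 + k) (4 + double k) ℤ.- ℤ.+ 4 ℤ.* diagonal (1 + k) (2 + double k) ℤ.+ ℤ.+ 4 ℤ.* diagonal k (double k)
      ≡⟨ cong₂ (λ a c → a ℤ.- ℤ.+ 4 ℤ.* diagonal (1 + k) (2 + double k) ℤ.+ ℤ.+ 4 ℤ.* c)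
               (diagonal-on (2 + k)) (diagonal-on k) ⟩
    ℤ.+ flatCount (2 + k) ℤ.- ℤ.+ 4 ℤ.* diagonal (1 + k) (2 + double k) ℤ.+ ℤ.+ 4 ℤ.* ℤ.+ flatCount k
      ≡⟨ cong (λ b → ℤ.+ flatCount (2 + k) ℤ.- ℤ.+ 4 ℤ.* b ℤ.+ ℤ.+ 4 ℤ.* ℤ.+ flatCount k) (diagonal-on (1 + k)) ⟩
    ℤ.+ flatCount (2 + k) ℤ.- ℤ.+ 4 ℤ.* ℤ.+ flatCount (1 + k) ℤ.+ ℤ.+ 4 ℤ.* ℤ.+ flatCount k
      ≡⟨ initial-or-recurrence k ⟩
    𝟙 k (double k) ∎
    where
    open ≡-Reasoning
    initial-or-recurrence : ∀ k → ℤ.+ flatCount (2 + k) ℤ.- ℤ.+ 4 ℤ.* ℤ.+ flatCount (1 + k)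
                                  ℤ.+ ℤ.+ 4 ℤ.* ℤ.+ flatCount k ≡ 𝟙 k (double k)
    initial-or-recurrence zero    = refl
    initial-or-recurrence (suc j) =
      ℤ-recurrence₄ (flatCount (3 + j)) (flatCount (2 + j)) (flatCount (1 + j)) (flatCount-recurrence j)
  ... | inj₂ n≢2k = begin
    diagonal (2 + k) (4 + n) ℤ.- ℤ.+ 4 ℤ.* diagonal (1 + k) (2 + n) ℤ.+ ℤ.+ 4 ℤ.* diagonal k n
      ≡⟨ cong₂ (λ a c → a ℤ.- ℤ.+ 4 ℤ.* diagonal (1 + k) (2 + n) ℤ.+ ℤ.+ 4 ℤ.* c)
               (diagonal-off (2 + k) (4 + n) (n≢2k ∘ ℕP.suc-injective ∘ ℕP.suc-injective ∘ ℕP.suc-injective ∘ ℕP.suc-injective))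
               (diagonal-off k n n≢2k) ⟩
    ℤ.+ 0 ℤ.- ℤ.+ 4 ℤ.* diagonal (1 + k) (2 + n) ℤ.+ ℤ.+ 0
      ≡⟨ cong (λ b → ℤ.+ 0 ℤ.- ℤ.+ 4 ℤ.* b ℤ.+ ℤ.+ 0) (diagonal-off (1 + k) (2 + n) (n≢2k ∘ ℕP.suc-injective ∘ ℕP.suc-injective)) ⟩
    ℤ.+ 0
      ≡⟨ sym (𝟙-off k n≢2k) ⟩
    𝟙 k n ∎
    where
    open ≡-Reasoning
    𝟙-off : ∀ {n} k → n ≢ double k → 𝟙 k n ≡ ℤ.+ 0
    𝟙-off {zero}  zero    0≢0 = contradiction refl 0≢0
    𝟙-off {suc n} zero    _   = refl
    𝟙-off         (suc k) _   = refl

  diagonal-core : ∀ k n → diagonal k n ℤ.- ℤ.+ 4 ℤ.* tx²· diagonal k n ℤ.+ ℤ.+ 4 ℤ.* tx²· (tx²· diagonal) k n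
                        ≡ 𝟙 k n ℤ.- ℤ.+ 2 ℤ.* tx²· 𝟙 k n ℤ.+ tx²· (tx²· 𝟙) k n
  diagonal-core zero                zero                      = refl
  diagonal-core zero                (suc n)                   = refl
  diagonal-core (suc k)             zero                      = refl
  diagonal-core (suc k)             (suc zero)                = refl
  diagonal-core (suc zero)          (suc (suc zero))          = refl
  diagonal-core (suc zero)          (suc (suc (suc n)))       = refl
  diagonal-core (suc (suc k))       (suc (suc zero))          = refl
  diagonal-core (suc (suc k))       (suc (suc (suc zero)))    = refl
  diagonal-core (suc (suc k)) (suc (suc (suc (suc n)))) = trans (diagonal-shifted k n) (sym (ℤP.+-identityˡ (𝟙 k n)))

  diagonal-recurrence : mulBy (1-2tx² *ᵖ 1-2tx²) diagonal ≗ˢ mulBy (1-tx² *ᵖ 1-tx²) 𝟙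
  diagonal-recurrence k n =
    trans (mulBy-[1-2tx²]² diagonal k n) (trans (diagonal-core k n) (sym (mulBy-[1-tx²]² 𝟙 k n)))

open Recurrences

numerator-identity : mulBy 1-tx-tx² (mulBy 1-tx² 𝟙) ⊕ mulBy 1-x-tx² (mulBy (𝐭 *ᵖ 𝐱) 𝟙) ≗ˢ mulBy numeratorᵖ 𝟙
numerator-identity 0 0 = refl
numerator-identity 0 1 = refl
numerator-identity 0 2 = refl
numerator-identity 0 3 = refl
numerator-identity 0 4 = refl
numerator-identity 0 (suc (suc (suc (suc (suc q))))) = refl
numerator-identity 1 0 = refl
numerator-identity 1 1 = refl
numerator-identity 1 2 = refl
numerator-identity 1 3 = refl
numerator-identity 1 4 = refl
numerator-identity 1 (suc (suc (suc (suc (suc q))))) = refl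
numerator-identity 2 0 = refl
numerator-identity 2 1 = refl
numerator-identity 2 2 = refl
numerator-identity 2 3 = refl
numerator-identity 2 4 = refl
numerator-identity 2 (suc (suc (suc (suc (suc q))))) = refl
numerator-identity (suc (suc (suc p))) 0 = refl
numerator-identity (suc (suc (suc p))) 1 = refl
numerator-identity (suc (suc (suc p))) 2 = refl
numerator-identity (suc (suc (suc p))) 3 = refl
numerator-identity (suc (suc (suc p))) 4 = refl
numerator-identity (suc (suc (suc p))) (suc (suc (suc (suc (suc q))))) = refl

genA½-identity : genA½ classCount ⊛ den₂ ≗ˢ num₂
genA½-identity p q = begin
  (lower ⊛ ⟦ 1-x-tx² *ᵖ BB ⟧) p q       ≡⟨ ⊛-⟦⟧ lower (1-x-tx² *ᵖ BB) p q ⟩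
  mulBy BB (mulBy 1-x-tx² lower) p q    ≡⟨ mulBy-cong BB lower-recurrence p q ⟩
  mulBy BB (mulBy 1-tx² diagonal) p q   ≡⟨ mulBy-comm BB 1-tx² diagonal p q ⟩
  mulBy 1-tx² (mulBy BB diagonal) p q   ≡⟨ mulBy-cong 1-tx² diagonal-recurrence p q ⟩
  mulBy (CC *ᵖ 1-tx²) 𝟙 p q             ≡⟨ sym (⟦⟧≗mulBy-𝟙 (CC *ᵖ 1-tx²) p q) ⟩
  num₂ p q                              ∎
  where
  open ≡-Reasoning
  BB = 1-2tx² *ᵖ 1-2tx²
  CC = 1-tx² *ᵖ 1-tx²

genA-identity : genA classCount ⊛ den₁ ≗ˢ num₁
genA-identity p q = begin
  (genA classCount ⊛ ⟦ den₁ᵖ ⟧) p q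
    ≡⟨ ⊛-⟦⟧ (genA classCount) den₁ᵖ p q ⟩
  mulBy den₁ᵖ (genA classCount) p q
    ≡⟨ trans (mulBy-cong den₁ᵖ genA-split p q) (mulBy-⊕ den₁ᵖ lower upper p q) ⟩
  (mulBy den₁ᵖ lower ⊕ mulBy den₁ᵖ upper) p q
    ≡⟨ ⊕-cong lower-part upper-part p q ⟩
  (mulBy CC A ⊕ mulBy CC B) p q
    ≡⟨ sym (mulBy-⊕ CC A B p q) ⟩
  mulBy CC (A ⊕ B) p q
    ≡⟨ mulBy-cong CC numerator-identity p q ⟩
  mulBy (numeratorᵖ *ᵖ CC) 𝟙 p q
    ≡⟨ sym (⟦⟧≗mulBy-𝟙 (numeratorᵖ *ᵖ CC) p q) ⟩
  num₁ p q ∎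
  where
  open ≡-Reasoning
  BB = 1-2tx² *ᵖ 1-2tx²
  CC = 1-tx² *ᵖ 1-tx²
  den₁ᵖ = 1-tx-tx² *ᵖ 1-x-tx² *ᵖ BB
  A = mulBy 1-tx-tx² (mulBy 1-tx² 𝟙)
  B = mulBy 1-x-tx² (mulBy (𝐭 *ᵖ 𝐱) 𝟙)
  C₁ = 1-tx² *ᵖ 1-tx-tx²
  C₂ = 𝐭 *ᵖ 𝐱 *ᵖ 1-x-tx²
  lower-part : mulBy den₁ᵖ lower ≗ˢ mulBy CC A
  lower-part p q = begin
    mulBy BB (mulBy 1-x-tx² (mulBy 1-tx-tx² lower)) p q ≡⟨ mulBy-cong BB (mulBy-comm 1-x-tx² 1-tx-tx² lower) p q ⟩
    mulBy BB (mulBy 1-tx-tx² (mulBy 1-x-tx² lower)) p q ≡⟨ mulBy-cong BB (mulBy-cong 1-tx-tx² lower-recurrence) p q ⟩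
    mulBy BB (mulBy C₁ diagonal) p q                    ≡⟨ mulBy-comm BB C₁ diagonal p q ⟩
    mulBy C₁ (mulBy BB diagonal) p q                    ≡⟨ mulBy-cong C₁ diagonal-recurrence p q ⟩
    mulBy C₁ (mulBy CC 𝟙) p q                           ≡⟨ mulBy-comm C₁ CC 𝟙 p q ⟩
    mulBy CC A p q                                      ∎
  upper-part : mulBy den₁ᵖ upper ≗ˢ mulBy CC B
  upper-part p q = begin
    mulBy BB (mulBy 1-x-tx² (mulBy 1-tx-tx² upper)) p q ≡⟨ mulBy-cong BB (mulBy-cong 1-x-tx² upper-recurrence) p q ⟩
    mulBy BB (mulBy C₂ diagonal) p q                    ≡⟨ mulBy-comm BB C₂ diagonal p q ⟩
    mulBy C₂ (mulBy BB diagonal) p q                    ≡⟨ mulBy-cong C₂ diagonal-recurrence p q ⟩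
    mulBy C₂ (mulBy CC 𝟙) p q                           ≡⟨ mulBy-comm C₂ CC 𝟙 p q ⟩
    mulBy CC B p q                                      ∎

theorem6p4 : Σ (ℕ → ℕ → ℕ) λ a →
               (∀ n k → k ≤ n → NumClasses n k (a n k)) ×
               (genA a ⊛ den₁ ≗ˢ num₁) ×
               (genA½ a ⊛ den₂ ≗ˢ num₂)
theorem6p4 = classCount , numClasses , genA-identity , genA½-identity
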